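{- Let $p$ be an odd prime, $d\ge 2$ an integer, $c\in\mathbb{F}_p^\times$, and $N_d=1+\#\{(x,y)\in\mathbb{F}_p^2: y^2=x^d+cx\}$. Let $T$ be a fixed generator of $\widehat{\mathbb{F}_p^\times}$ and $\phi=T^{(p-1)/2}$. Then $$N_d=p+1+\sum_{m} T_{d'}^{2m+1}(-c)\,\phi(c)\,J(T_{d'}^{2m+1},\phi),$$ where the sum is over all $m\in\mathbb{Z}$ such that $\frac{(2m+1)(p-1)}{2(d-1)}$ is an integer lying in $[0,p-2]$, and $T_{d'}^{2m+1}$ denotes the character $T^{(2m+1)(p-1)/(2(d-1))}$.
   Context: Multiplicative characters are extended to $\mathbb{F}_p$ by $\chi(0)=0$. The Jacobi sum is $J(A,B)=\sum_{x\in\mathbb{F}_p}A(x)B(1-x)$. -}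

module Defs where

open import Level using (Level)
open import Data.Nat using (ℕ; zero; suc; _∸_; _≟_; _<_; _≤_; ∣_-_∣)
open import Data.Nat.Divisibility using (_∣_; _∣?_)
import Data.Nat as N
open import Data.Fin using (Fin; toℕ)
open import Data.List using (List; []; _∷_; foldr; map; upTo; allFin; cartesianProduct)
open import Data.Product using (_×_; _,_; ∃)
open import Data.Sum using (_⊎_)
open import Relation.Nullary using (¬_; yes; no)
open import Relation.Binary.PropositionalEquality using (_≡_; _≢_)
open import Algebra.Bundles using (CommutativeRing)

curveCount : (p d c : ℕ) → ℕ
curveCount p d c = foldr N._+_ 0 (map f (cartesianProduct (upTo p) (upTo p)))
  where
  f : ℕ × ℕ → ℕ
  f (x , y) with p ∣? ∣ y N.^ 2 - (x N.^ d N.+ c N.* x) ∣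
  ... | yes _ = 1
  ... | no  _ = 0

Nd : (p d c : ℕ) → ℕ
Nd p d c = suc (curveCount p d c)

module _ {a ℓ : Level} (R : CommutativeRing a ℓ) where
  open CommutativeRing R

  fromℕ : ℕ → Carrier
  fromℕ zero    = 0#
  fromℕ (suc n) = 1# + fromℕ n

  pow : Carrier → ℕ → Carrier
  pow x zero    = 1#
  pow x (suc n) = x * pow x n

  sumR : ℕ → (ℕ → Carrier) → Carrier
  sumR n f = foldr _+_ 0# (map f (upTo n))

  IsIntegralDomain : Set (a Level.⊔ ℓ)
  IsIntegralDomain = ∀ x y → x * y ≈ 0# → x ≈ 0# ⊎ y ≈ 0#

  CharZero : Set ℓ
  CharZero = ∀ n → ¬ (fromℕ (suc n) ≈ 0#)

  -- A multiplicative character of F_p^×, extended to F_p by χ(0) = 0,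
  -- represented as a function on ℕ depending only on the residue mod p.
  -- (p * c ∸ c below represents -c mod p; (1 + p) ∸ x represents 1 - x.)
  record IsCharacter (p : ℕ) (T : ℕ → Carrier) : Set (a Level.⊔ ℓ) where
    field
      periodic : ∀ x → T (x N.+ p) ≈ T x
      mult     : ∀ x y → T (x N.* y) ≈ T x * T y
      at-zero  : T 0 ≈ 0#
      at-one   : T 1 ≈ 1#

  IsGenerator : (p : ℕ) → (ℕ → Carrier) → Set ℓ
  IsGenerator p T = ∀ k → 0 < k → k < p ∸ 1 →
    ¬ (∀ x → ¬ (p ∣ x) → pow (T x) k ≈ 1#)

  charPow : (p : ℕ) → (ℕ → Carrier) → ℕ → ℕ → Carrier
  charPow p T k x with p ∣? x
  ... | yes _ = 0#
  ... | no  _ = pow (T x) k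

  jacobi : (p : ℕ) → (ℕ → Carrier) → (ℕ → Carrier) → Carrier
  jacobi p A B = sumR p (λ x → A x * B ((1 N.+ p) ∸ x))

  -- term of the sum for a given m ≥ 0: if e := (2m+1)(p-1)/(2(d-1)) is an
  -- integer with 0 ≤ e ≤ p-2, it contributes T^e(-c) φ(c) J(T^e, φ);
  -- otherwise 0. (The inner sum has at most one nonzero summand.)
  term : (p d c : ℕ) → (ℕ → Carrier) → ℕ → Carrier
  term p d c T m = sumR (p ∸ 1) g
    where
    φ : ℕ → Carrier
    φ = charPow p T ((p ∸ 1) N./ 2)
    g : ℕ → Carrier
    g e with e N.* (2 N.* (d ∸ 1)) ≟ (1 N.+ 2 N.* m) N.* (p ∸ 1)
    ... | yes _ = charPow p T e (p N.* c ∸ c) * φ c * jacobi p (charPow p T e) φ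
    ... | no  _ = 0#

  -- Σ over all admissible m. Negative m never qualify (the quotient would be
  -- negative), and admissible m satisfy m < d - 1, so m < d * p covers all.
  mainSum : (p d c : ℕ) → (ℕ → Carrier) → Carrier
  mainSum p d c T = sumR (d N.* p) (term p d c T)

module Submission where

-- Counting square roots, #{y : y² = a} = 1 + φ(a), gives N_d = p + 1 + Σₓ φ(x^d + c x).
-- On the other side, the substitution x = -c t turns T^e(-c) φ(c) J(T^e, φ) into
-- Σᵤ T^e(u) φ(c + u). The admissible exponents are the e < p - 1 with
-- e (d - 1) ≡ (p - 1)/2 mod p - 1, and by orthogonality of the characters T^j,
-- Σ_{e admissible} T^e(u) = Σ_{x^(d-1) = u} φ(x). So the right-hand side is
-- Σₓ φ(x) φ(c + x^(d-1)) = Σₓ φ(x^d + c x). Orthogonality rests on Fermat, T(u)^(p-1) = 1,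
-- and on T being a generator: Σₓ T^j(x) is fixed by multiplication with T^j(z), so it
-- vanishes unless T^j is trivial, i.e. unless p - 1 divides j.

open import Defs
open import Level using (Level)
open import Algebra.Bundles using (CommutativeMonoid; CommutativeRing)
open import Data.Nat as ℕ
  using (ℕ; zero; suc; _∸_; _<_; _≤_; z≤n; s≤s; NonZero; _%_; _/_; ∣_-_∣)
import Data.Nat.Properties as ℕ
open import Data.Nat.DivMod
  using (m%n<n; m≡m%n+[m/n]*n; m<n⇒m%n≡m; %-distribˡ-+; %-distribˡ-*; m%n%n≡m%n; m%n≤n; [m+n]%n≡m%n; [m+kn]%n≡m%n; n%n≡0; %-remove-+ʳ; m*n/n≡m)
open import Data.Nat.Divisibility using (_∣_; _∣?_; divides; m%n≡0⇒n∣m; n∣m⇒m%n≡0; ∣⇒≤; ∣n⇒∣m*n; ∣m⇒∣m*n; ∣-refl; ∣m+n∣m⇒∣n)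
open import Data.Nat.Primality using (Prime; euclidsLemma; prime⇒nonZero; prime⇒nonTrivial)
open import Data.Nat.Coprimality using (prime⇒coprime; coprime-Bézout)
open import Data.Nat.GCD using (module Bézout)
open import Data.Nat.Tactic.RingSolver using (solve-∀)
open import Data.Fin using (Fin; toℕ; fromℕ<)
open import Data.Fin.Properties using (toℕ<n; toℕ-fromℕ<; toℕ-injective)
open import Data.Fin.Permutation using (permutation)
open import Data.List using (List; []; _∷_; foldr; map; applyUpTo; upTo; cartesianProduct; _++_)
open import Data.List.Properties using (map-∘)
open import Data.Product using (_×_; _,_; ∃-syntax; proj₁; proj₂)
open import Data.Sum using (_⊎_; inj₁; inj₂; [_,_]′)
open import Data.Empty using (⊥-elim)
open import Function using (id; _∘_; _⇔_; mk⇔; Equivalence)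
import Function.Properties.Equivalence as ⇔
open import Relation.Nullary using (¬_; Dec; yes; no)
open import Relation.Nullary.Decidable using (toSum)
open import Relation.Binary.PropositionalEquality as ≡ using (_≡_; _≢_)

module FiniteSum {c ℓ} (M : CommutativeMonoid c ℓ) where
  open CommutativeMonoid M
  import Algebra.Properties.CommutativeMonoid.Sum M as Sum

  ∑ : ℕ → (ℕ → Carrier) → Carrier
  ∑ n f = Sum.sum {n} (f ∘ toℕ)

  ∑-cong : ∀ n {f g : ℕ → Carrier} → (∀ i → i < n → f i ≈ g i) → ∑ n f ≈ ∑ n g
  ∑-cong zero eq = refl
  ∑-cong (suc n) eq = ∙-cong (eq 0 (s≤s z≤n)) (∑-cong n (λ i i<n → eq (suc i) (s≤s i<n)))

  ∑-distrib : ∀ n (f g : ℕ → Carrier) → ∑ n (λ i → f i ∙ g i) ≈ ∑ n f ∙ ∑ n g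
  ∑-distrib n f g = Sum.∑-distrib-+ {n} (f ∘ toℕ) (g ∘ toℕ)

  ∑-comm : ∀ m n (f : ℕ → ℕ → Carrier) →
           ∑ m (λ i → ∑ n (f i)) ≈ ∑ n (λ j → ∑ m (λ i → f i j))
  ∑-comm m n f = Sum.∑-comm {m} {n} (λ i j → f (toℕ i) (toℕ j))

  ∑-zero : ∀ n {f : ℕ → Carrier} → (∀ i → i < n → f i ≈ ε) → ∑ n f ≈ ε
  ∑-zero zero eq = refl
  ∑-zero (suc n) eq =
    trans (∙-cong (eq 0 (s≤s z≤n)) (∑-zero n (λ i i<n → eq (suc i) (s≤s i<n)))) (identityˡ ε)

  ∑-split : ∀ m n (f : ℕ → Carrier) → ∑ (m ℕ.+ n) f ≈ ∑ m f ∙ ∑ n (λ i → f (m ℕ.+ i))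
  ∑-split zero n f = sym (identityˡ _)
  ∑-split (suc m) n f = trans (∙-congˡ (∑-split m n (f ∘ suc))) (sym (assoc _ _ _))

  ∑-single : ∀ n y {f : ℕ → Carrier} → y < n → (∀ x → x < n → x ≢ y → f x ≈ ε) → ∑ n f ≈ f y
  ∑-single (suc n) zero _ eq =
    trans (∙-congˡ (∑-zero n (λ i i<n → eq (suc i) (s≤s i<n) λ ()))) (identityʳ _)
  ∑-single (suc n) (suc y) (s≤s y<n) eq =
    trans (∙-cong (eq 0 (s≤s z≤n) λ ())
                  (∑-single n y y<n (λ x x<n x≢y → eq (suc x) (s≤s x<n) (x≢y ∘ ℕ.suc-injective))))
          (identityˡ _)

  ∑-reindex : ∀ n (σ τ : ℕ → ℕ) → (∀ x → x < n → σ x < n) → (∀ x → x < n → τ x < n) →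
              (∀ x → x < n → σ (τ x) ≡ x) → (∀ x → x < n → τ (σ x) ≡ x) →
              (f : ℕ → Carrier) → ∑ n f ≈ ∑ n (f ∘ σ)
  ∑-reindex n σ τ σ<n τ<n στ τσ f =
    trans (Sum.∑-permute {n} {n} (f ∘ toℕ) π)
          (reflexive (Sum.sum-cong-≗ {n} (λ i → ≡.cong f (toℕ-fromℕ< (σ<n (toℕ i) (toℕ<n i))))))
    where
    restrict : (g : ℕ → ℕ) → (∀ x → x < n → g x < n) → Fin n → Fin n
    restrict g g<n i = fromℕ< (g<n (toℕ i) (toℕ<n i))
    restrict-inverse : ∀ g h g<n h<n → (∀ x → x < n → g (h x) ≡ x) →
                       ∀ i → restrict g g<n (restrict h h<n i) ≡ i
    restrict-inverse g h g<n h<n gh i = toℕ-injective (≡.trans (toℕ-fromℕ< _)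
      (≡.trans (≡.cong g (toℕ-fromℕ< _)) (gh (toℕ i) (toℕ<n i))))
    π = permutation (restrict σ σ<n) (restrict τ τ<n)
                    (restrict-inverse σ τ σ<n τ<n στ) (restrict-inverse τ σ τ<n σ<n τσ)

  sumList : ∀ {a} {A : Set a} → List A → (A → Carrier) → Carrier
  sumList xs f = foldr _∙_ ε (map f xs)

  sumList-applyUpTo : ∀ n (g : ℕ → ℕ) (f : ℕ → Carrier) → sumList (applyUpTo g n) f ≈ ∑ n (f ∘ g)
  sumList-applyUpTo zero g f = refl
  sumList-applyUpTo (suc n) g f = ∙-congˡ (sumList-applyUpTo n (g ∘ suc) f)

  sumList-++ : ∀ {a} {A : Set a} (xs ys : List A) (f : A → Carrier) →
               sumList (xs ++ ys) f ≈ sumList xs f ∙ sumList ys f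
  sumList-++ [] ys f = sym (identityˡ _)
  sumList-++ (x ∷ xs) ys f = trans (∙-congˡ (sumList-++ xs ys f)) (sym (assoc _ _ _))

  sumList-cartesianProduct : ∀ {a b} {A : Set a} {B : Set b} (xs : List A) (ys : List B)
    (f : A × B → Carrier) →
    sumList (cartesianProduct xs ys) f ≈ sumList xs (λ x → sumList ys (λ y → f (x , y)))
  sumList-cartesianProduct [] ys f = refl
  sumList-cartesianProduct (x ∷ xs) ys f =
    trans (sumList-++ (map (x ,_) ys) _ f)
          (∙-cong (reflexive (≡.cong (foldr _∙_ ε) (≡.sym (map-∘ ys))))
                  (sumList-cartesianProduct xs ys f))

module Residue (n : ℕ) .{{_ : NonZero n}} where

  infix 4 _≋_ _≋?_
  _≋_ : ℕ → ℕ → Set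
  x ≋ y = x % n ≡ y % n

  _≋?_ : ∀ x y → Dec (x ≋ y)
  x ≋? y = x % n ℕ.≟ y % n

  ≋-refl : ∀ {x} → x ≋ x
  ≋-refl = ≡.refl

  ≋-sym : ∀ {x y} → x ≋ y → y ≋ x
  ≋-sym = ≡.sym

  ≋-trans : ∀ {x y z} → x ≋ y → y ≋ z → x ≋ z
  ≋-trans = ≡.trans

  ≡⇒≋ : ∀ {x y} → x ≡ y → x ≋ y
  ≡⇒≋ = ≡.cong (_% n)

  ≋-+ : ∀ {a b c d} → a ≋ b → c ≋ d → a ℕ.+ c ≋ b ℕ.+ d
  ≋-+ {a} {b} {c} {d} a≋b c≋d = ≡.trans (%-distribˡ-+ a c n)
    (≡.trans (≡.cong₂ (λ u v → (u ℕ.+ v) % n) a≋b c≋d) (≡.sym (%-distribˡ-+ b d n)))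

  ≋-* : ∀ {a b c d} → a ≋ b → c ≋ d → a ℕ.* c ≋ b ℕ.* d
  ≋-* {a} {b} {c} {d} a≋b c≋d = ≡.trans (%-distribˡ-* a c n)
    (≡.trans (≡.cong₂ (λ u v → (u ℕ.* v) % n) a≋b c≋d) (≡.sym (%-distribˡ-* b d n)))

  %-≋ : ∀ x → x % n ≋ x
  %-≋ x = m%n%n≡m%n x n

  +*-≋ : ∀ x k → x ℕ.+ k ℕ.* n ≋ x
  +*-≋ x k = [m+kn]%n≡m%n x k n

  n≋0 : n ≋ 0
  n≋0 = ≡.trans (n%n≡0 n) (≡.sym (m<n⇒m%n≡m (ℕ.>-nonZero⁻¹ n)))

  ≋⇒≡ : ∀ {x y} → x < n → y < n → x ≋ y → x ≡ y
  ≋⇒≡ x<n y<n x≋y = ≡.trans (≡.sym (m<n⇒m%n≡m x<n)) (≡.trans x≋y (m<n⇒m%n≡m y<n))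

  ≋-cancelʳ-+ : ∀ {a b} c → a ℕ.+ c ≋ b ℕ.+ c → a ≋ b
  ≋-cancelʳ-+ {a} {b} c eq = begin
    a % n                           ≡⟨ ≡.cong (_% n) (ℕ.+-identityʳ a) ⟨
    (a ℕ.+ 0) % n                   ≡⟨ ≋-+ (≋-refl {a}) (≋-sym c+c′≋0) ⟩
    (a ℕ.+ (c ℕ.+ c′)) % n          ≡⟨ ≡.cong (_% n) (ℕ.+-assoc a c c′) ⟨
    ((a ℕ.+ c) ℕ.+ c′) % n          ≡⟨ ≋-+ eq (≋-refl {c′}) ⟩
    ((b ℕ.+ c) ℕ.+ c′) % n          ≡⟨ ≡.cong (_% n) (ℕ.+-assoc b c c′) ⟩
    (b ℕ.+ (c ℕ.+ c′)) % n          ≡⟨ ≋-+ (≋-refl {b}) c+c′≋0 ⟩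
    (b ℕ.+ 0) % n                   ≡⟨ ≡.cong (_% n) (ℕ.+-identityʳ b) ⟩
    b % n                           ∎
    where
    open ≡.≡-Reasoning
    c′ = n ∸ c % n
    c+c′≋0 : c ℕ.+ c′ ≋ 0
    c+c′≋0 = ≋-trans (≋-+ (≋-sym (%-≋ c)) (≋-refl {c′}))
                     (≋-trans (≡⇒≋ (ℕ.m+[n∸m]≡n (m%n≤n c n))) n≋0)

  ∣⇒≋0 : ∀ {x} → n ∣ x → x ≋ 0
  ∣⇒≋0 {x} n∣x = ≡.trans (n∣m⇒m%n≡0 x n n∣x) (≡.sym (m<n⇒m%n≡m (ℕ.>-nonZero⁻¹ n)))

  ≋0⇒∣ : ∀ {x} → x ≋ 0 → n ∣ x
  ≋0⇒∣ {x} x≋0 = m%n≡0⇒n∣m x n (≡.trans x≋0 (m<n⇒m%n≡m (ℕ.>-nonZero⁻¹ n)))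

  ≤⇒≋⇔∣∸ : ∀ {a b} → a ≤ b → a ≋ b ⇔ n ∣ b ∸ a
  ≤⇒≋⇔∣∸ {a} {b} a≤b = mk⇔
    (λ a≋b → ≋0⇒∣ (≋-cancelʳ-+ a (≡.trans (≡⇒≋ (ℕ.m∸n+n≡m a≤b)) (≋-sym a≋b))))
    (λ n∣b∸a → ≡.trans (≡.sym (%-remove-+ʳ a n∣b∸a)) (≡⇒≋ (ℕ.m+[n∸m]≡n a≤b)))

  ≋⇔∣∣-∣ : ∀ a b → a ≋ b ⇔ n ∣ ∣ a - b ∣
  ≋⇔∣∣-∣ a b with ℕ.≤-total a b
  ... | inj₁ a≤b = ≡.subst (λ m → a ≋ b ⇔ n ∣ m)
                     (≡.trans (≡.sym (ℕ.m≤n⇒∣n-m∣≡n∸m a≤b)) (ℕ.∣-∣-comm b a)) (≤⇒≋⇔∣∸ a≤b)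
  ... | inj₂ b≤a = ≡.subst (λ m → a ≋ b ⇔ n ∣ m) (≡.sym (ℕ.m≤n⇒∣n-m∣≡n∸m b≤a))
                     (mk⇔ (Equivalence.to (≤⇒≋⇔∣∸ b≤a) ∘ ≋-sym) (≋-sym ∘ Equivalence.from (≤⇒≋⇔∣∸ b≤a)))

  ∣-resp-≋ : ∀ {x y} → x ≋ y → n ∣ x → n ∣ y
  ∣-resp-≋ x≋y n∣x = ≋0⇒∣ (≋-trans (≋-sym x≋y) (∣⇒≋0 n∣x))

  *%-cancel : ∀ {u v} → u ℕ.* v ≋ 1 → ∀ x → x < n → (v ℕ.* ((u ℕ.* x) % n)) % n ≡ x
  *%-cancel {u} {v} uv≋1 x x<n = ≋⇒≡ (m%n<n _ n) x<n (begin
    (v ℕ.* ((u ℕ.* x) % n)) % n % n  ≡⟨ %-≋ _ ⟩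
    (v ℕ.* ((u ℕ.* x) % n)) % n      ≡⟨ ≋-* (≋-refl {v}) (%-≋ (u ℕ.* x)) ⟩
    (v ℕ.* (u ℕ.* x)) % n            ≡⟨ ≡⇒≋ (ℕ.*-assoc v u x) ⟨
    (v ℕ.* u ℕ.* x) % n              ≡⟨ ≋-* (≋-trans (≡⇒≋ (ℕ.*-comm v u)) uv≋1) (≋-refl {x}) ⟩
    (1 ℕ.* x) % n                    ≡⟨ ≡⇒≋ (ℕ.*-identityˡ x) ⟩
    x % n                            ∎)
    where open ≡.≡-Reasoning

  ≋⇔*≋1 : ∀ {a b} → a ℕ.* b ≋ 1 → ∀ z → z ≋ a ⇔ z ℕ.* b ≋ 1
  ≋⇔*≋1 {a} {b} ab≋1 z = mk⇔
    (λ z≋a → ≋-trans (≋-* z≋a (≋-refl {b})) ab≋1)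
    (λ zb≋1 → begin
      z % n                 ≡⟨ ≡⇒≋ (ℕ.*-identityʳ z) ⟨
      (z ℕ.* 1) % n         ≡⟨ ≋-* (≋-refl {z}) (≋-trans (≋-sym ab≋1) (≡⇒≋ (ℕ.*-comm a b))) ⟩
      (z ℕ.* (b ℕ.* a)) % n ≡⟨ ≡⇒≋ (ℕ.*-assoc z b a) ⟨
      (z ℕ.* b ℕ.* a) % n   ≡⟨ ≋-* zb≋1 (≋-refl {a}) ⟩
      (1 ℕ.* a) % n         ≡⟨ ≡⇒≋ (ℕ.*-identityˡ a) ⟩
      a % n                 ∎)
    where open ≡.≡-Reasoning

  c*[1+n∸t]≋c+w*t : ∀ {c w} t → t ≤ suc n → w ℕ.+ c ≡ n ℕ.* c → c ℕ.* (suc n ∸ t) ≋ c ℕ.+ (w ℕ.* t) % n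
  c*[1+n∸t]≋c+w*t {c} {w} t t≤1+n w+c≡nc = ≋-cancelʳ-+ (c ℕ.* t) (≋-trans lhs≋c (≋-sym rhs≋c))
    where
    open ≡.≡-Reasoning
    lhs≋c : c ℕ.* (suc n ∸ t) ℕ.+ c ℕ.* t ≋ c
    lhs≋c = begin
      (c ℕ.* (suc n ∸ t) ℕ.+ c ℕ.* t) % n   ≡⟨ ≡.cong (_% n) (ℕ.*-distribˡ-+ c _ t) ⟨
      (c ℕ.* (suc n ∸ t ℕ.+ t)) % n         ≡⟨ ≡.cong (λ z → (c ℕ.* z) % n) (ℕ.m∸n+n≡m t≤1+n) ⟩
      (c ℕ.* suc n) % n                     ≡⟨ ≡.cong (_% n) (expand c n) ⟩
      (c ℕ.+ c ℕ.* n) % n                   ≡⟨ +*-≋ c c ⟩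
      c % n                                 ∎
      where
      expand : ∀ c n → c ℕ.* suc n ≡ c ℕ.+ c ℕ.* n
      expand = solve-∀
    rhs≋c : c ℕ.+ (w ℕ.* t) % n ℕ.+ c ℕ.* t ≋ c
    rhs≋c = begin
      (c ℕ.+ (w ℕ.* t) % n ℕ.+ c ℕ.* t) % n   ≡⟨ ≋-+ (≋-+ (≋-refl {c}) (%-≋ (w ℕ.* t))) (≋-refl {c ℕ.* t}) ⟩
      (c ℕ.+ w ℕ.* t ℕ.+ c ℕ.* t) % n         ≡⟨ ≡.cong (_% n) (collect c w t) ⟩
      (c ℕ.+ (w ℕ.+ c) ℕ.* t) % n             ≡⟨ ≡.cong (λ z → (c ℕ.+ z ℕ.* t) % n) w+c≡nc ⟩
      (c ℕ.+ n ℕ.* c ℕ.* t) % n               ≡⟨ ≡.cong (_% n) (reorder c n t) ⟩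
      (c ℕ.+ c ℕ.* t ℕ.* n) % n               ≡⟨ +*-≋ c (c ℕ.* t) ⟩
      c % n                                   ∎
      where
      collect : ∀ c w t → c ℕ.+ w ℕ.* t ℕ.+ c ℕ.* t ≡ c ℕ.+ (w ℕ.+ c) ℕ.* t
      collect = solve-∀
      reorder : ∀ c n t → c ℕ.+ n ℕ.* c ℕ.* t ≡ c ℕ.+ c ℕ.* t ℕ.* n
      reorder = solve-∀

  neg : ℕ → ℕ
  neg x = (n ∸ x) % n

  neg-+ : ∀ {x} → x ≤ n → neg x ℕ.+ x ≋ 0
  neg-+ {x} x≤n = ≋-trans (≋-+ (%-≋ (n ∸ x)) (≋-refl {x})) (≋-trans (≡⇒≋ (ℕ.m∸n+n≡m x≤n)) n≋0)

  neg-involutive : ∀ {x} → x < n → neg (neg x) ≡ x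
  neg-involutive {x} x<n = ≋⇒≡ (m%n<n _ n) x<n (≋-cancelʳ-+ (neg x) (≋-trans
    (neg-+ (ℕ.<⇒≤ (m%n<n _ n))) (≋-sym (≋-trans (≡⇒≋ (ℕ.+-comm x (neg x))) (neg-+ (ℕ.<⇒≤ x<n))))))

  ∣+*neg⇔*≋ : ∀ {e} h k → e ≤ n → n ∣ h ℕ.+ k ℕ.* neg e ⇔ e ℕ.* k ≋ h
  ∣+*neg⇔*≋ {e} h k e≤n = mk⇔
    (λ n∣h+k·neg → ≋-cancelʳ-+ (k ℕ.* neg e) (≋-trans ek+k·neg≋0 (≋-sym (∣⇒≋0 n∣h+k·neg))))
    (λ ek≋h → ≋0⇒∣ (≋-trans (≋-+ (≋-sym ek≋h) (≋-refl {k ℕ.* neg e})) ek+k·neg≋0))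
    where
    ek+k·neg≋0 : e ℕ.* k ℕ.+ k ℕ.* neg e ≋ 0
    ek+k·neg≋0 = begin
      (e ℕ.* k ℕ.+ k ℕ.* neg e) % n   ≡⟨ ≡.cong (λ m → (m ℕ.+ k ℕ.* neg e) % n) (ℕ.*-comm e k) ⟩
      (k ℕ.* e ℕ.+ k ℕ.* neg e) % n   ≡⟨ ≡.cong (_% n) (ℕ.*-distribˡ-+ k e (neg e)) ⟨
      (k ℕ.* (e ℕ.+ neg e)) % n       ≡⟨ ≋-* (≋-refl {k}) (≋-trans (≡⇒≋ (ℕ.+-comm e (neg e))) (neg-+ e≤n)) ⟩
      (k ℕ.* 0) % n                   ≡⟨ ≡.cong (_% n) (ℕ.*-zeroʳ k) ⟩
      0 % n                           ∎
      where open ≡.≡-Reasoning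

  module _ {c ℓ} (M : CommutativeMonoid c ℓ) where
    open CommutativeMonoid M using (_≈_)
    open FiniteSum M

    ∑-reindex-* : ∀ {u v} → u ℕ.* v ≋ 1 → ∀ f → ∑ n f ≈ ∑ n (λ x → f ((u ℕ.* x) % n))
    ∑-reindex-* {u} {v} uv≋1 f =
      ∑-reindex n (λ x → (u ℕ.* x) % n) (λ x → (v ℕ.* x) % n) (λ x _ → m%n<n _ n) (λ x _ → m%n<n _ n)
        (*%-cancel {v} {u} (≋-trans (≡⇒≋ (ℕ.*-comm v u)) uv≋1)) (*%-cancel {u} {v} uv≋1) f

module PrimeModulus (p : ℕ) (pr : Prime p) where

  instance
    p≢0 : NonZero p
    p≢0 = prime⇒nonZero pr

  open Residue p public

  1<p : 1 < p
  1<p = ℕ.nonTrivial⇒n>1 p {{prime⇒nonTrivial pr}}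

  p∤-* : ∀ {x y} → ¬ p ∣ x → ¬ p ∣ y → ¬ p ∣ x ℕ.* y
  p∤-* {x} {y} p∤x p∤y p∣xy with euclidsLemma x y pr p∣xy
  ... | inj₁ p∣x = p∤x p∣x
  ... | inj₂ p∣y = p∤y p∣y

  <p⇒p∤ : ∀ {x} → x < p → x ≢ 0 → ¬ p ∣ x
  <p⇒p∤ {zero} _ 0≢0 _ = 0≢0 ≡.refl
  <p⇒p∤ {suc x} x<p _ p∣x = ℕ.<-irrefl ≡.refl (ℕ.<-≤-trans x<p (∣⇒≤ p∣x))

  p∤1 : ¬ p ∣ 1
  p∤1 = <p⇒p∤ 1<p (λ ())

  p∤-^ : ∀ {x} n → ¬ p ∣ x → ¬ p ∣ x ℕ.^ n
  p∤-^ zero _ = p∤1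
  p∤-^ (suc n) p∤x = p∤-* p∤x (p∤-^ n p∤x)

  p∣^⇒p∣ : ∀ {x} n → p ∣ x ℕ.^ suc n → p ∣ x
  p∣^⇒p∣ {x} n p∣xⁿ⁺¹ with euclidsLemma x (x ℕ.^ n) pr p∣xⁿ⁺¹
  ... | inj₁ p∣x = p∣x
  ... | inj₂ p∣xⁿ with n
  ...   | zero = ⊥-elim (p∤1 p∣xⁿ)
  ...   | suc m = p∣^⇒p∣ m p∣xⁿ

  inverse-p∤ : ∀ {x y} → x ℕ.* y ≋ 1 → ¬ p ∣ y
  inverse-p∤ {x} xy≋1 p∣y = p∤1 (∣-resp-≋ xy≋1 (∣n⇒∣m*n x p∣y))

  inverse : ∀ x → ¬ p ∣ x → ∃[ y ] x ℕ.* y ≋ 1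
  inverse x p∤x with coprime-Bézout (prime⇒coprime pr {{x%p≢0}} (m%n<n x p))
    where
    x%p≢0 : NonZero (x % p)
    x%p≢0 = ℕ.≢-nonZero (p∤x ∘ m%n≡0⇒n∣m x p)
  ... | Bézout.-+ a b 1+ap≡bx = b , (begin
    (x ℕ.* b) % p            ≡⟨ ≋-* (≋-sym (%-≋ x)) (≋-refl {b}) ⟩
    (x % p ℕ.* b) % p        ≡⟨ ≡⇒≋ (ℕ.*-comm (x % p) b) ⟩
    (b ℕ.* (x % p)) % p      ≡⟨ ≡⇒≋ 1+ap≡bx ⟨
    (1 ℕ.+ a ℕ.* p) % p      ≡⟨ +*-≋ 1 a ⟩
    1 % p                    ∎)
    where open ≡.≡-Reasoning
  -- Here b x ≡ -1, so b (p - 1) is an inverse.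
  ... | Bézout.+- a b 1+bx≡ap = b ℕ.* (p ∸ 1) , ≋-cancelʳ-+ p (begin
    (x ℕ.* (b ℕ.* (p ∸ 1)) ℕ.+ p) % p          ≡⟨ ≋-+ (≋-* (≋-sym (%-≋ x)) (≋-refl {b ℕ.* (p ∸ 1)})) (≋-refl {p}) ⟩
    (x % p ℕ.* (b ℕ.* (p ∸ 1)) ℕ.+ p) % p      ≡⟨ ≡⇒≋ (≡.trans (≡.cong (x % p ℕ.* (b ℕ.* (p ∸ 1)) ℕ.+_) p≡1+[p∸1]) (identity (x % p) b (p ∸ 1))) ⟩
    (1 ℕ.+ (1 ℕ.+ b ℕ.* (x % p)) ℕ.* (p ∸ 1)) % p ≡⟨ ≡⇒≋ (≡.cong (λ m → 1 ℕ.+ m ℕ.* (p ∸ 1)) 1+bx≡ap) ⟩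
    (1 ℕ.+ a ℕ.* p ℕ.* (p ∸ 1)) % p            ≡⟨ ≡⇒≋ (≡.cong (1 ℕ.+_) (ℕ.*-comm (a ℕ.* p) (p ∸ 1))) ⟩
    (1 ℕ.+ (p ∸ 1) ℕ.* (a ℕ.* p)) % p          ≡⟨ ≡⇒≋ (≡.cong (1 ℕ.+_) (ℕ.*-assoc (p ∸ 1) a p)) ⟨
    (1 ℕ.+ (p ∸ 1) ℕ.* a ℕ.* p) % p            ≡⟨ +*-≋ 1 ((p ∸ 1) ℕ.* a) ⟩
    1 % p                                       ≡⟨ [m+n]%n≡m%n 1 p ⟨
    (1 ℕ.+ p) % p                              ∎)
    where
    open ≡.≡-Reasoning
    p≡1+[p∸1] : p ≡ 1 ℕ.+ (p ∸ 1)
    p≡1+[p∸1] = ≡.sym (ℕ.m+[n∸m]≡n (ℕ.<⇒≤ 1<p))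
    identity : ∀ x b q → x ℕ.* (b ℕ.* q) ℕ.+ (1 ℕ.+ q) ≡ 1 ℕ.+ (1 ℕ.+ b ℕ.* x) ℕ.* q
    identity = solve-∀

module ℕSum = FiniteSum ℕ.+-0-commutativeMonoid

∑-≤ : ∀ n (f : ℕ → ℕ) i → i < n → f i ≤ ℕSum.∑ n f
∑-≤ (suc n) f zero _ = ℕ.m≤m+n (f 0) _
∑-≤ (suc n) f (suc i) (s≤s i<n) = ℕ.≤-trans (∑-≤ n (f ∘ suc) i i<n) (ℕ.m≤n+m _ (f 0))

∑-≥-pair : ∀ n (f : ℕ → ℕ) i j → i < n → j < n → i ≢ j → f i ℕ.+ f j ≤ ℕSum.∑ n f
∑-≥-pair (suc n) f zero zero _ _ i≢j = ⊥-elim (i≢j ≡.refl)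
∑-≥-pair (suc n) f zero (suc j) _ (s≤s j<n) _ = ℕ.+-monoʳ-≤ (f 0) (∑-≤ n (f ∘ suc) j j<n)
∑-≥-pair (suc n) f (suc i) zero (s≤s i<n) _ _ =
  ≡.subst (_≤ ℕSum.∑ (suc n) f) (ℕ.+-comm (f 0) (f (suc i))) (ℕ.+-monoʳ-≤ (f 0) (∑-≤ n (f ∘ suc) i i<n))
∑-≥-pair (suc n) f (suc i) (suc j) (s≤s i<n) (s≤s j<n) i≢j =
  ℕ.≤-trans (∑-≥-pair n (f ∘ suc) i j i<n j<n (i≢j ∘ ≡.cong suc)) (ℕ.m≤n+m _ (f 0))

⊎-∀< : ∀ {a b} {A : Set a} {B : ℕ → Set b} n → (∀ i → i < n → A ⊎ B i) → A ⊎ (∀ i → i < n → B i)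
⊎-∀< zero _ = inj₂ (λ _ ())
⊎-∀< (suc n) A⊎B with A⊎B n ℕ.≤-refl | ⊎-∀< n (λ i i<n → A⊎B i (ℕ.m<n⇒m<1+n i<n))
... | inj₁ a | _ = inj₁ a
... | inj₂ _ | inj₁ a = inj₁ a
... | inj₂ bₙ | inj₂ b = inj₂ λ i i<1+n → [ b i , (λ { ≡.refl → bₙ }) ]′ (ℕ.m<1+n⇒m<n∨m≡n i<1+n)

module RingFacts {a ℓ} (R : CommutativeRing a ℓ) where
  open CommutativeRing R
  open import Relation.Binary.Reasoning.Setoid setoid
  open import Algebra.Properties.Semiring.Exp semiring public using (_^_; ^-congˡ; ^-homo-*; ^-assocʳ)
  open import Algebra.Properties.CommutativeSemiring.Exp commutativeSemiring public using (^-distrib-*)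
  open import Algebra.Properties.Group +-group public using (x∙y⁻¹≈ε⇒x≈y; x≈y⇒x∙y⁻¹≈ε)
    renaming (∙-cancelˡ to +-cancelˡ; ∙-cancelʳ to +-cancelʳ)
  open import Algebra.Properties.Ring ring public using (x[y-z]≈xy-xz)
  open FiniteSum +-commutativeMonoid public
  open FiniteSum *-commutativeMonoid public using ()
    renaming (∑ to ∏; ∑-cong to ∏-cong; ∑-distrib to ∏-distrib)

  pow≡^ : ∀ x n → pow R x n ≡ x ^ n
  pow≡^ x zero = ≡.refl
  pow≡^ x (suc n) = ≡.cong (x *_) (pow≡^ x n)

  1#^ : ∀ n → 1# ^ n ≈ 1#
  1#^ zero = refl
  1#^ (suc n) = trans (*-identityˡ _) (1#^ n)

  ∏-const : ∀ n x → ∏ n (λ _ → x) ≈ x ^ n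
  ∏-const zero x = refl
  ∏-const (suc n) x = *-congˡ (∏-const n x)

  fromℕ-+ : ∀ m n → fromℕ R (m ℕ.+ n) ≈ fromℕ R m + fromℕ R n
  fromℕ-+ zero n = sym (+-identityˡ _)
  fromℕ-+ (suc m) n = trans (+-congˡ (fromℕ-+ m n)) (sym (+-assoc _ _ _))

  fromℕ-∑ : ∀ n (f : ℕ → ℕ) → fromℕ R (ℕSum.∑ n f) ≈ ∑ n (fromℕ R ∘ f)
  fromℕ-∑ zero f = refl
  fromℕ-∑ (suc n) f = trans (fromℕ-+ (f 0) _) (+-congˡ (fromℕ-∑ n (f ∘ suc)))

  fromℕ-sumList : ∀ {b} {A : Set b} (xs : List A) (f : A → ℕ) →
                  fromℕ R (ℕSum.sumList xs f) ≈ sumList xs (fromℕ R ∘ f)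
  fromℕ-sumList [] f = refl
  fromℕ-sumList (x ∷ xs) f = trans (fromℕ-+ (f x) _) (+-congˡ (fromℕ-sumList xs f))

  sumR≈∑ : ∀ n f → sumR R n f ≈ ∑ n f
  sumR≈∑ n f = sumList-applyUpTo n id f

  ∑-1# : ∀ n → ∑ n (λ _ → 1#) ≈ fromℕ R n
  ∑-1# zero = refl
  ∑-1# (suc n) = +-congˡ (∑-1# n)

  ∑-*ˡ : ∀ n x (f : ℕ → Carrier) → x * ∑ n f ≈ ∑ n (λ i → x * f i)
  ∑-*ˡ zero x f = zeroʳ x
  ∑-*ˡ (suc n) x f = trans (distribˡ x _ _) (+-congˡ (∑-*ˡ n x (f ∘ suc)))

  ∑-*ʳ : ∀ n x (f : ℕ → Carrier) → ∑ n f * x ≈ ∑ n (λ i → f i * x)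
  ∑-*ʳ n x f = trans (*-comm _ x) (trans (∑-*ˡ n x f) (∑-cong n (λ i _ → *-comm x (f i))))

  ∑-pow-shift : ∀ w n → 1# + w * ∑ n (w ^_) ≈ ∑ n (w ^_) + w ^ n
  ∑-pow-shift w n = begin
    1# + w * ∑ n (w ^_)                  ≈⟨ +-congˡ (∑-*ˡ n w (w ^_)) ⟩
    ∑ (suc n) (w ^_)                     ≡⟨ ≡.cong (λ m → ∑ m (w ^_)) (ℕ.+-comm 1 n) ⟩
    ∑ (n ℕ.+ 1) (w ^_)                   ≈⟨ ∑-split n 1 (w ^_) ⟩
    ∑ n (w ^_) + (w ^ (n ℕ.+ 0) + 0#)    ≈⟨ +-congˡ (trans (+-identityʳ _) (reflexive (≡.cong (w ^_) (ℕ.+-identityʳ n)))) ⟩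
    ∑ n (w ^_) + w ^ n                   ∎

  ∑-pow-invariant : ∀ w n → w ^ n ≈ 1# → w * ∑ n (w ^_) ≈ ∑ n (w ^_)
  ∑-pow-invariant w n wⁿ≈1 = +-cancelʳ 1# _ _
    (trans (+-comm _ 1#) (trans (∑-pow-shift w n) (+-congˡ wⁿ≈1)))

  𝟙 : ∀ {b} {P : Set b} → Dec P → Carrier
  𝟙 (yes _) = 1#
  𝟙 (no _) = 0#

  𝟙-yes : ∀ {b} {P : Set b} (d : Dec P) → P → 𝟙 d ≈ 1#
  𝟙-yes (yes _) _ = refl
  𝟙-yes (no ¬p) p = ⊥-elim (¬p p)

  𝟙-no : ∀ {b} {P : Set b} (d : Dec P) → ¬ P → 𝟙 d ≈ 0#
  𝟙-no (yes p) ¬p = ⊥-elim (¬p p)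
  𝟙-no (no _) _ = refl

  𝟙-cong : ∀ {b c} {P : Set b} {Q : Set c} (d : Dec P) (e : Dec Q) → P ⇔ Q → 𝟙 d ≈ 𝟙 e
  𝟙-cong (yes p) e P⇔Q = sym (𝟙-yes e (Equivalence.to P⇔Q p))
  𝟙-cong (no ¬p) e P⇔Q = sym (𝟙-no e (¬p ∘ Equivalence.from P⇔Q))

module IntegralDomainFacts {a ℓ} (R : CommutativeRing a ℓ) (dom : IsIntegralDomain R) where
  open CommutativeRing R
  open RingFacts R
  open import Relation.Binary.Reasoning.Setoid setoid

  *-cancelˡ-≉0 : ∀ {z x y} → ¬ z ≈ 0# → z * x ≈ z * y → x ≈ y
  *-cancelˡ-≉0 {z} {x} {y} z≉0 zx≈zy with dom z (x - y) z[x-y]≈0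
    where
    z[x-y]≈0 : z * (x - y) ≈ 0#
    z[x-y]≈0 = trans (x[y-z]≈xy-xz z x y) (x≈y⇒x∙y⁻¹≈ε zx≈zy)
  ... | inj₁ z≈0 = ⊥-elim (z≉0 z≈0)
  ... | inj₂ x-y≈0 = x∙y⁻¹≈ε⇒x≈y x y x-y≈0

  *-fixed : ∀ {w s} → w * s ≈ s → w ≈ 1# ⊎ s ≈ 0#
  *-fixed {w} {s} ws≈s with dom (w - 1#) s [w-1]s≈0
    where
    [w-1]s≈0 : (w - 1#) * s ≈ 0#
    [w-1]s≈0 = begin
      (w - 1#) * s      ≈⟨ *-comm _ s ⟩
      s * (w - 1#)      ≈⟨ x[y-z]≈xy-xz s w 1# ⟩
      s * w - s * 1#    ≈⟨ +-cong (trans (*-comm s w) ws≈s) (-‿cong (*-identityʳ s)) ⟩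
      s - s             ≈⟨ -‿inverseʳ s ⟩
      0#                ∎
  ... | inj₁ w-1≈0 = inj₁ (x∙y⁻¹≈ε⇒x≈y w 1# w-1≈0)
  ... | inj₂ s≈0 = inj₂ s≈0

  ∏-≉0 : ¬ 1# ≈ 0# → ∀ n (f : ℕ → Carrier) → (∀ i → ¬ f i ≈ 0#) → ¬ ∏ n f ≈ 0#
  ∏-≉0 1≉0 zero f f≉0 = 1≉0
  ∏-≉0 1≉0 (suc n) f f≉0 ∏≈0 with dom _ _ ∏≈0
  ... | inj₁ f0≈0 = f≉0 0 f0≈0
  ... | inj₂ ∏≈0′ = ∏-≉0 1≉0 n (f ∘ suc) (f≉0 ∘ suc) ∏≈0′

module CharZeroFacts {a ℓ} (R : CommutativeRing a ℓ) (ch0 : CharZero R) where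
  open CommutativeRing R
  open RingFacts R

  1#≉0# : ¬ 1# ≈ 0#
  1#≉0# 1≈0 = ch0 0 (trans (+-identityʳ 1#) 1≈0)

  fromℕ-injective : ∀ m n → fromℕ R m ≈ fromℕ R n → m ≡ n
  fromℕ-injective zero zero _ = ≡.refl
  fromℕ-injective zero (suc n) eq = ⊥-elim (ch0 n (sym eq))
  fromℕ-injective (suc m) zero eq = ⊥-elim (ch0 m eq)
  fromℕ-injective (suc m) (suc n) eq = ≡.cong suc (fromℕ-injective m n (+-cancelˡ 1# _ _ eq))

module Characters {a ℓ} (R : CommutativeRing a ℓ) (dom : IsIntegralDomain R) (ch0 : CharZero R)
  (p : ℕ) (pr : Prime p) (T : ℕ → CommutativeRing.Carrier R)
  (isC : IsCharacter R p T) (gen : IsGenerator R p T) where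

  open CommutativeRing R
  open RingFacts R
  open IntegralDomainFacts R dom
  open CharZeroFacts R ch0
  open PrimeModulus p pr
  open IsCharacter isC
  open import Relation.Binary.Reasoning.Setoid setoid
  open import Algebra.Solver.Ring.NaturalCoefficients.Default commutativeSemiring
    using (solve; _:=_; _:*_)

  q : ℕ
  q = p ∸ 1

  p≡1+q : p ≡ suc q
  p≡1+q = ≡.sym (ℕ.m+[n∸m]≡n (ℕ.<⇒≤ 1<p))

  0<q : 0 < q
  0<q = ℕ.m<n⇒0<n∸m 1<p

  instance
    q≢0 : NonZero q
    q≢0 = ℕ.>-nonZero 0<q

  T-+* : ∀ x k → T (x ℕ.+ k ℕ.* p) ≈ T x
  T-+* x zero = reflexive (≡.cong T (ℕ.+-identityʳ x))
  T-+* x (suc k) = begin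
    T (x ℕ.+ (p ℕ.+ k ℕ.* p))  ≡⟨ ≡.cong T (shift x p (k ℕ.* p)) ⟩
    T (x ℕ.+ k ℕ.* p ℕ.+ p)    ≈⟨ periodic _ ⟩
    T (x ℕ.+ k ℕ.* p)          ≈⟨ T-+* x k ⟩
    T x                        ∎
    where
    shift : ∀ x p y → x ℕ.+ (p ℕ.+ y) ≡ x ℕ.+ y ℕ.+ p
    shift = solve-∀

  T-≋ : ∀ {x y} → x ≋ y → T x ≈ T y
  T-≋ {x} {y} x≋y = begin
    T x                         ≡⟨ ≡.cong T (m≡m%n+[m/n]*n x p) ⟩
    T (x % p ℕ.+ x / p ℕ.* p)   ≈⟨ T-+* (x % p) (x / p) ⟩
    T (x % p)                   ≡⟨ ≡.cong T x≋y ⟩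
    T (y % p)                   ≈⟨ T-+* (y % p) (y / p) ⟨
    T (y % p ℕ.+ y / p ℕ.* p)   ≡⟨ ≡.cong T (m≡m%n+[m/n]*n y p) ⟨
    T y                         ∎

  T-≉0 : ∀ {x} → ¬ p ∣ x → ¬ T x ≈ 0#
  T-≉0 {x} p∤x Tx≈0 with inverse x p∤x
  ... | y , xy≋1 = 1#≉0# (begin
    1#           ≈⟨ at-one ⟨
    T 1          ≈⟨ T-≋ xy≋1 ⟨
    T (x ℕ.* y)  ≈⟨ mult x y ⟩
    T x * T y    ≈⟨ *-congʳ Tx≈0 ⟩
    0# * T y     ≈⟨ zeroˡ _ ⟩
    0#           ∎)

  χ : ℕ → ℕ → Carrier
  χ = charPow R p T

  χ-p∤ : ∀ k {x} → ¬ p ∣ x → χ k x ≈ T x ^ k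
  χ-p∤ k {x} p∤x with p ∣? x
  ... | yes p∣x = ⊥-elim (p∤x p∣x)
  ... | no _ = reflexive (pow≡^ (T x) k)

  χ-p∣ : ∀ k {x} → p ∣ x → χ k x ≈ 0#
  χ-p∣ k {x} p∣x with p ∣? x
  ... | yes _ = refl
  ... | no p∤x = ⊥-elim (p∤x p∣x)

  χ-≋ : ∀ k {x y} → x ≋ y → χ k x ≈ χ k y
  χ-≋ k {x} {y} x≋y = [ χ-≋-p∣ , χ-≋-p∤ ]′ (toSum (p ∣? x))
    where
    χ-≋-p∣ : p ∣ x → χ k x ≈ χ k y
    χ-≋-p∣ p∣x = trans (χ-p∣ k p∣x) (sym (χ-p∣ k (∣-resp-≋ x≋y p∣x)))
    χ-≋-p∤ : ¬ p ∣ x → χ k x ≈ χ k y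
    χ-≋-p∤ p∤x = begin
      χ k x     ≈⟨ χ-p∤ k p∤x ⟩
      T x ^ k   ≈⟨ ^-congˡ k (T-≋ x≋y) ⟩
      T y ^ k   ≈⟨ χ-p∤ k (p∤x ∘ ∣-resp-≋ (≋-sym x≋y)) ⟨
      χ k y     ∎

  χ-* : ∀ k x y → χ k (x ℕ.* y) ≈ χ k x * χ k y
  χ-* k x y = [ χ-*-p∣ , (λ p∤x → [ χ-*-p∤p∣ p∤x , χ-*-p∤p∤ p∤x ]′ (toSum (p ∣? y))) ]′ (toSum (p ∣? x))
    where
    χ-*-p∣ : p ∣ x → χ k (x ℕ.* y) ≈ χ k x * χ k y
    χ-*-p∣ p∣x = trans (χ-p∣ k (∣m⇒∣m*n y p∣x)) (sym (trans (*-congʳ (χ-p∣ k p∣x)) (zeroˡ _)))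
    χ-*-p∤p∣ : ¬ p ∣ x → p ∣ y → χ k (x ℕ.* y) ≈ χ k x * χ k y
    χ-*-p∤p∣ _ p∣y = trans (χ-p∣ k (∣n⇒∣m*n x p∣y)) (sym (trans (*-congˡ (χ-p∣ k p∣y)) (zeroʳ _)))
    χ-*-p∤p∤ : ¬ p ∣ x → ¬ p ∣ y → χ k (x ℕ.* y) ≈ χ k x * χ k y
    χ-*-p∤p∤ p∤x p∤y = begin
      χ k (x ℕ.* y)         ≈⟨ χ-p∤ k (p∤-* p∤x p∤y) ⟩
      T (x ℕ.* y) ^ k       ≈⟨ ^-congˡ k (mult x y) ⟩
      (T x * T y) ^ k       ≈⟨ ^-distrib-* (T x) (T y) k ⟩
      T x ^ k * T y ^ k     ≈⟨ *-cong (χ-p∤ k p∤x) (χ-p∤ k p∤y) ⟨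
      χ k x * χ k y         ∎

  χ-+ : ∀ j k x → χ (j ℕ.+ k) x ≈ χ j x * χ k x
  χ-+ j k x = [ χ-+-p∣ , χ-+-p∤ ]′ (toSum (p ∣? x))
    where
    χ-+-p∣ : p ∣ x → χ (j ℕ.+ k) x ≈ χ j x * χ k x
    χ-+-p∣ p∣x = trans (χ-p∣ _ p∣x) (sym (trans (*-congʳ (χ-p∣ j p∣x)) (zeroˡ _)))
    χ-+-p∤ : ¬ p ∣ x → χ (j ℕ.+ k) x ≈ χ j x * χ k x
    χ-+-p∤ p∤x = begin
      χ (j ℕ.+ k) x        ≈⟨ χ-p∤ (j ℕ.+ k) p∤x ⟩
      T x ^ (j ℕ.+ k)      ≈⟨ ^-homo-* (T x) j k ⟩
      T x ^ j * T x ^ k    ≈⟨ *-cong (χ-p∤ j p∤x) (χ-p∤ k p∤x) ⟨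
      χ j x * χ k x        ∎

  χ-^ : ∀ j k x → χ j (x ℕ.^ suc k) ≈ χ (suc k ℕ.* j) x
  χ-^ j k x = [ χ-^-p∣ , χ-^-p∤ ]′ (toSum (p ∣? x))
    where
    χ-^-p∣ : p ∣ x → χ j (x ℕ.^ suc k) ≈ χ (suc k ℕ.* j) x
    χ-^-p∣ p∣x = trans (χ-p∣ j (∣m⇒∣m*n (x ℕ.^ k) p∣x)) (sym (χ-p∣ _ p∣x))
    T-^ : ∀ n → T (x ℕ.^ n) ≈ T x ^ n
    T-^ zero = at-one
    T-^ (suc n) = trans (mult x (x ℕ.^ n)) (*-congˡ (T-^ n))
    χ-^-p∤ : ¬ p ∣ x → χ j (x ℕ.^ suc k) ≈ χ (suc k ℕ.* j) x
    χ-^-p∤ p∤x = begin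
      χ j (x ℕ.^ suc k)        ≈⟨ χ-p∤ j (p∤-^ (suc k) p∤x) ⟩
      T (x ℕ.^ suc k) ^ j      ≈⟨ ^-congˡ j (T-^ (suc k)) ⟩
      (T x ^ suc k) ^ j        ≈⟨ ^-assocʳ (T x) (suc k) j ⟩
      T x ^ (suc k ℕ.* j)      ≈⟨ χ-p∤ (suc k ℕ.* j) p∤x ⟨
      χ (suc k ℕ.* j) x        ∎

  χ₀ : ∀ {x} → ¬ p ∣ x → χ 0 x ≈ 1#
  χ₀ = χ-p∤ 0

  χ-1 : ∀ k → χ k 1 ≈ 1#
  χ-1 k = trans (χ-p∤ k p∤1) (trans (^-congˡ k at-one) (1#^ k))

  unitOr1 : ℕ → Carrier → Carrier
  unitOr1 x t with p ∣? x
  ... | yes _ = 1#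
  ... | no _ = t

  unitOr1-p∣ : ∀ {x} t → p ∣ x → unitOr1 x t ≈ 1#
  unitOr1-p∣ {x} t p∣x with p ∣? x
  ... | yes _ = refl
  ... | no p∤x = ⊥-elim (p∤x p∣x)

  unitOr1-p∤ : ∀ {x} t → ¬ p ∣ x → unitOr1 x t ≈ t
  unitOr1-p∤ {x} t p∤x with p ∣? x
  ... | yes p∣x = ⊥-elim (p∤x p∣x)
  ... | no _ = refl

  ∏-unitOr1 : ∀ t → ∏ p (λ x → unitOr1 x t) ≈ t ^ q
  ∏-unitOr1 t = begin
    ∏ p (λ x → unitOr1 x t)                              ≡⟨ ≡.cong (λ n → ∏ n (λ x → unitOr1 x t)) p≡1+q ⟩
    unitOr1 0 t * ∏ q (λ i → unitOr1 (suc i) t)          ≈⟨ *-cong (unitOr1-p∣ t (divides 0 ≡.refl)) (∏-cong q (λ i i<q →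
                                                               unitOr1-p∤ t (<p⇒p∤ (≡.subst (suc i <_) (≡.sym p≡1+q) (s≤s i<q)) λ ()))) ⟩
    1# * ∏ q (λ _ → t)                                   ≈⟨ *-identityˡ _ ⟩
    ∏ q (λ _ → t)                                        ≈⟨ ∏-const q t ⟩
    t ^ q                                                ∎

  -- x ↦ u x permutes the residues, so ∏ G = T u ^ q * ∏ G with ∏ G ≠ 0.
  T^q≈1 : ∀ {u} → ¬ p ∣ u → T u ^ q ≈ 1#
  T^q≈1 {u} p∤u with inverse u p∤u
  ... | v , uv≋1 = sym (*-cancelˡ-≉0 ∏G≉0 (begin
    ∏ p G * 1#                   ≈⟨ *-identityʳ _ ⟩
    ∏ p G                        ≈⟨ ∑-reindex-* *-commutativeMonoid {u} {v} uv≋1 G ⟩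
    ∏ p (λ x → G ((u ℕ.* x) % p)) ≈⟨ ∏-cong p (λ x _ → G-* x) ⟩
    ∏ p (λ x → H x * G x)        ≈⟨ ∏-distrib p H G ⟩
    ∏ p H * ∏ p G                ≈⟨ *-congʳ (∏-unitOr1 (T u)) ⟩
    T u ^ q * ∏ p G              ≈⟨ *-comm _ _ ⟩
    ∏ p G * T u ^ q              ∎))
    where
    G H : ℕ → Carrier
    G x = unitOr1 x (T x)
    H x = unitOr1 x (T u)
    ∏G≉0 : ¬ ∏ p G ≈ 0#
    ∏G≉0 = ∏-≉0 1#≉0# p G G≉0
      where
      G≉0 : ∀ x → ¬ G x ≈ 0#
      G≉0 x with p ∣? x
      ... | yes _ = 1#≉0#
      ... | no p∤x = T-≉0 p∤x
    G-* : ∀ x → G ((u ℕ.* x) % p) ≈ H x * G x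
    G-* x with p ∣? x
    ... | yes p∣x = trans (unitOr1-p∣ _ (∣-resp-≋ (≋-sym (%-≋ (u ℕ.* x))) (∣n⇒∣m*n u p∣x)))
                          (sym (*-identityˡ 1#))
    ... | no p∤x = begin
      G ((u ℕ.* x) % p)     ≈⟨ unitOr1-p∤ _ (p∤-* p∤u p∤x ∘ ∣-resp-≋ (%-≋ (u ℕ.* x))) ⟩
      T ((u ℕ.* x) % p)     ≈⟨ T-≋ (%-≋ (u ℕ.* x)) ⟩
      T (u ℕ.* x)           ≈⟨ mult u x ⟩
      T u * T x             ∎

  χ-+q : ∀ j x → χ (j ℕ.+ q) x ≈ χ j x
  χ-+q j x = [ χ-+q-p∣ , χ-+q-p∤ ]′ (toSum (p ∣? x))
    where
    χ-+q-p∣ : p ∣ x → χ (j ℕ.+ q) x ≈ χ j x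
    χ-+q-p∣ p∣x = trans (χ-p∣ _ p∣x) (sym (χ-p∣ j p∣x))
    χ-+q-p∤ : ¬ p ∣ x → χ (j ℕ.+ q) x ≈ χ j x
    χ-+q-p∤ p∤x = begin
      χ (j ℕ.+ q) x        ≈⟨ χ-+ j q x ⟩
      χ j x * χ q x        ≈⟨ *-congˡ (trans (χ-p∤ q p∤x) (T^q≈1 p∤x)) ⟩
      χ j x * 1#           ≈⟨ *-identityʳ _ ⟩
      χ j x                ∎

  χ-+*q : ∀ r t x → χ (r ℕ.+ t ℕ.* q) x ≈ χ r x
  χ-+*q r zero x = reflexive (≡.cong (λ j → χ j x) (ℕ.+-identityʳ r))
  χ-+*q r (suc t) x = begin
    χ (r ℕ.+ (q ℕ.+ t ℕ.* q)) x  ≡⟨ ≡.cong (λ j → χ j x) (shift r q (t ℕ.* q)) ⟩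
    χ (r ℕ.+ t ℕ.* q ℕ.+ q) x    ≈⟨ χ-+q _ x ⟩
    χ (r ℕ.+ t ℕ.* q) x          ≈⟨ χ-+*q r t x ⟩
    χ r x                        ∎
    where
    shift : ∀ x q y → x ℕ.+ (q ℕ.+ y) ≡ x ℕ.+ y ℕ.+ q
    shift = solve-∀

  χ-%q : ∀ j x → χ j x ≈ χ (j % q) x
  χ-%q j x = trans (reflexive (≡.cong (λ i → χ i x) (m≡m%n+[m/n]*n j q))) (χ-+*q (j % q) (j / q) x)

  S : ℕ → Carrier
  S j = ∑ p (χ j)

  S-0 : S 0 ≈ fromℕ R q
  S-0 = begin
    ∑ p (χ 0)                             ≡⟨ ≡.cong (λ n → ∑ n (χ 0)) p≡1+q ⟩
    χ 0 0 + ∑ q (λ i → χ 0 (suc i))       ≈⟨ +-cong (χ-p∣ 0 (divides 0 ≡.refl)) (∑-cong q (λ i i<q →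
                                               χ₀ (<p⇒p∤ (≡.subst (suc i <_) (≡.sym p≡1+q) (s≤s i<q)) λ ()))) ⟩
    0# + ∑ q (λ _ → 1#)                   ≈⟨ +-identityˡ _ ⟩
    ∑ q (λ _ → 1#)                        ≈⟨ ∑-1# q ⟩
    fromℕ R q                             ∎

  S-invariant : ∀ j {z} → ¬ p ∣ z → χ j z * S j ≈ S j
  S-invariant j {z} p∤z with inverse z p∤z
  ... | v , zv≋1 = sym (begin
    ∑ p (χ j)                              ≈⟨ ∑-reindex-* +-commutativeMonoid {z} {v} zv≋1 (χ j) ⟩
    ∑ p (λ x → χ j ((z ℕ.* x) % p))        ≈⟨ ∑-cong p (λ x _ → trans (χ-≋ j (%-≋ (z ℕ.* x))) (χ-* j z x)) ⟩
    ∑ p (λ x → χ j z * χ j x)              ≈⟨ ∑-*ˡ p (χ j z) (χ j) ⟨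
    χ j z * ∑ p (χ j)                      ∎)

  S-<q : ∀ j → 0 < j → j < q → S j ≈ 0#
  S-<q j 0<j j<q = [ (λ S≈0 → S≈0) , (λ Tᶻʲ≈1 → ⊥-elim (gen j 0<j j<q (T^j≈1 Tᶻʲ≈1))) ]′
                     (⊎-∀< p (λ z _ → S≈0-or-Tᶻʲ≈1 z))
    where
    S≈0-or-Tᶻʲ≈1 : ∀ z → S j ≈ 0# ⊎ (¬ p ∣ z → T z ^ j ≈ 1#)
    S≈0-or-Tᶻʲ≈1 z = [ (λ p∣z → inj₂ (λ p∤z → ⊥-elim (p∤z p∣z))) , S≈0-or-Tᶻʲ≈1-p∤ ]′ (toSum (p ∣? z))
      where
      S≈0-or-Tᶻʲ≈1-p∤ : ¬ p ∣ z → S j ≈ 0# ⊎ (¬ p ∣ z → T z ^ j ≈ 1#)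
      S≈0-or-Tᶻʲ≈1-p∤ p∤z = [ (λ χz≈1 → inj₂ (λ _ → trans (sym (χ-p∤ j p∤z)) χz≈1)) , inj₁ ]′
                              (*-fixed (S-invariant j p∤z))
    T^j≈1 : (∀ z → z < p → ¬ p ∣ z → T z ^ j ≈ 1#) → ∀ x → ¬ p ∣ x → pow R (T x) j ≈ 1#
    T^j≈1 Tᶻʲ≈1 x p∤x = begin
      pow R (T x) j    ≡⟨ pow≡^ (T x) j ⟩
      T x ^ j          ≈⟨ ^-congˡ j (T-≋ (≋-sym (%-≋ x))) ⟩
      T (x % p) ^ j    ≈⟨ Tᶻʲ≈1 (x % p) (m%n<n x p) (p∤x ∘ ∣-resp-≋ (%-≋ x)) ⟩
      1#               ∎

  S≈q𝟙 : ∀ j → S j ≈ fromℕ R q * 𝟙 (q ∣? j)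
  S≈q𝟙 j = trans (∑-cong p (λ x _ → χ-%q j x)) (S%q≈ (q ∣? j))
    where
    S%q≈ : (d : Dec (q ∣ j)) → S (j % q) ≈ fromℕ R q * 𝟙 d
    S%q≈ (yes q∣j) = begin
      S (j % q)        ≡⟨ ≡.cong S (n∣m⇒m%n≡0 j q q∣j) ⟩
      S 0              ≈⟨ S-0 ⟩
      fromℕ R q        ≈⟨ *-identityʳ _ ⟨
      fromℕ R q * 1#   ∎
    S%q≈ (no q∤j) = trans (S-<q (j % q) (ℕ.n≢0⇒n>0 (q∤j ∘ m%n≡0⇒n∣m j q)) (m%n<n j q)) (sym (zeroʳ _))

  D : ℕ → Carrier
  D x = ∑ q (λ j → χ j x)

  D-fromℕ : ∀ x → ∃[ m ] D x ≈ fromℕ R m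
  D-fromℕ x = [ (λ p∣x → 0 , ∑-zero q (λ j _ → χ-p∣ j p∣x)) , D-fromℕ-p∤ ]′ (toSum (p ∣? x))
    where
    D-fromℕ-p∤ : ¬ p ∣ x → ∃[ m ] D x ≈ fromℕ R m
    D-fromℕ-p∤ p∤x = [ (λ Tx≈1 → q , (begin
        D x                  ≈⟨ D≈∑ ⟩
        ∑ q (T x ^_)         ≈⟨ ∑-cong q (λ j _ → trans (^-congˡ j Tx≈1) (1#^ j)) ⟩
        ∑ q (λ _ → 1#)       ≈⟨ ∑-1# q ⟩
        fromℕ R q            ∎))
      , (λ ∑≈0 → 0 , trans D≈∑ ∑≈0) ]′ (*-fixed (∑-pow-invariant (T x) q (T^q≈1 p∤x)))
      where
      D≈∑ : D x ≈ ∑ q (T x ^_)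
      D≈∑ = ∑-cong q (λ j _ → χ-p∤ j p∤x)

  D-1 : D 1 ≈ fromℕ R q
  D-1 = trans (∑-cong q (λ j _ → χ-1 j)) (∑-1# q)

  ∑D : ∑ p D ≈ fromℕ R q
  ∑D = begin
    ∑ p D                    ≈⟨ ∑-comm p q (λ x j → χ j x) ⟩
    ∑ q S                    ≈⟨ ∑-single q 0 {S} 0<q (λ j j<q j≢0 → S-<q j (ℕ.n≢0⇒n>0 j≢0) j<q) ⟩
    S 0                      ≈⟨ S-0 ⟩
    fromℕ R q                ∎

  -- Every D x is a natural number, they sum to q and D 1 = q, so all the others vanish.
  D-≢1 : ∀ x → x < p → x ≢ 1 → D x ≈ 0#
  D-≢1 x x<p x≢1 = trans (proj₂ (D-fromℕ x)) (reflexive (≡.cong (fromℕ R) mₓ≡0))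
    where
    m : ℕ → ℕ
    m = proj₁ ∘ D-fromℕ
    ∑m≡q : ℕSum.∑ p m ≡ q
    ∑m≡q = fromℕ-injective _ _ (begin
      fromℕ R (ℕSum.∑ p m)       ≈⟨ fromℕ-∑ p m ⟩
      ∑ p (fromℕ R ∘ m)          ≈⟨ ∑-cong p (λ y _ → sym (proj₂ (D-fromℕ y))) ⟩
      ∑ p D                      ≈⟨ ∑D ⟩
      fromℕ R q                  ∎)
    m₁≡q : m 1 ≡ q
    m₁≡q = fromℕ-injective _ _ (trans (sym (proj₂ (D-fromℕ 1))) D-1)
    mₓ≡0 : m x ≡ 0
    mₓ≡0 = ℕ.n≤0⇒n≡0 (ℕ.+-cancelˡ-≤ q _ _ (≡.subst₂ _≤_ (≡.cong (ℕ._+ m x) m₁≡q)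
             (≡.trans ∑m≡q (≡.sym (ℕ.+-identityʳ q))) (∑-≥-pair p m 1 x 1<p x<p (x≢1 ∘ ≡.sym))))

  D≈q𝟙 : ∀ x → D x ≈ fromℕ R q * 𝟙 (x ≋? 1)
  D≈q𝟙 x = D≈ (x ≋? 1)
    where
    D≈ : (d : Dec (x ≋ 1)) → D x ≈ fromℕ R q * 𝟙 d
    D≈ (yes x≋1) = trans (∑-cong q (λ j _ → χ-≋ j x≋1)) (trans D-1 (sym (*-identityʳ _)))
    D≈ (no x≉1) = begin
      D x               ≈⟨ ∑-cong q (λ j _ → χ-≋ j (≋-sym (%-≋ x))) ⟩
      D (x % p)         ≈⟨ D-≢1 (x % p) (m%n<n x p) (λ x%p≡1 → x≉1 (≡.trans x%p≡1 (≡.sym (m<n⇒m%n≡m 1<p)))) ⟩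
      0#                ≈⟨ zeroʳ _ ⟨
      fromℕ R q * 0#    ∎

  𝟙≋≈D : ∀ {a b} → a ℕ.* b ≋ 1 → ∀ z → fromℕ R q * 𝟙 (z ≋? a) ≈ D (z ℕ.* b)
  𝟙≋≈D {a} {b} ab≋1 z =
    trans (*-congˡ (𝟙-cong (z ≋? a) (z ℕ.* b ≋? 1) (≋⇔*≋1 ab≋1 z))) (sym (D≈q𝟙 (z ℕ.* b)))

  χ-q∣ : ∀ {m x} → q ∣ m → ¬ p ∣ x → χ m x ≈ 1#
  χ-q∣ {m} {x} q∣m p∤x = begin
    χ m x         ≈⟨ χ-%q m x ⟩
    χ (m % q) x   ≡⟨ ≡.cong (λ j → χ j x) (n∣m⇒m%n≡0 m q q∣m) ⟩
    χ 0 x         ≈⟨ χ₀ p∤x ⟩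
    1#            ∎

  module Modq = Residue q

  χ-neg : ∀ {e u b} → e < q → u ℕ.* b ≋ 1 → χ (Modq.neg e) b ≈ χ e u
  χ-neg {e} {u} {b} e<q ub≋1 = begin
    χ e′ b                        ≈⟨ *-identityˡ _ ⟨
    1# * χ e′ b                   ≈⟨ *-congʳ (χ-q∣ q∣e+e′ (inverse-p∤ {b} bu≋1)) ⟨
    χ (e ℕ.+ e′) u * χ e′ b       ≈⟨ *-congʳ (χ-+ e e′ u) ⟩
    χ e u * χ e′ u * χ e′ b       ≈⟨ *-assoc _ _ _ ⟩
    χ e u * (χ e′ u * χ e′ b)     ≈⟨ *-congˡ (χ-* e′ u b) ⟨
    χ e u * χ e′ (u ℕ.* b)        ≈⟨ *-congˡ (trans (χ-≋ e′ ub≋1) (χ-1 e′)) ⟩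
    χ e u * 1#                    ≈⟨ *-identityʳ _ ⟩
    χ e u                         ∎
    where
    e′ = Modq.neg e
    q∣e+e′ : q ∣ e ℕ.+ e′
    q∣e+e′ = Modq.≋0⇒∣ (Modq.≋-trans (Modq.≡⇒≋ (ℕ.+-comm e e′)) (Modq.neg-+ (ℕ.<⇒≤ e<q)))
    bu≋1 : b ℕ.* u ≋ 1
    bu≋1 = ≋-trans (≡⇒≋ (ℕ.*-comm b u)) ub≋1

  S-+q : ∀ j → S (j ℕ.+ q) ≈ S j
  S-+q j = ∑-cong p (λ x _ → χ-+q j x)

  fromℕq≉0 : ¬ fromℕ R q ≈ 0#
  fromℕq≉0 q≈0 = ℕ.<-irrefl (≡.sym (fromℕ-injective q 0 q≈0)) 0<q

  -- q times the right side expands, via 𝟙≋≈D and S≈q𝟙, to q Σⱼ T^j(u⁻¹) [q ∣ r + k j],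
  -- which is q times the left side reindexed by e = -j.
  ∑-χ-roots-p∤ : ∀ r k′ {u} → ¬ p ∣ u →
    ∑ q (λ e → 𝟙 (e ℕ.* suc k′ Modq.≋? r) * χ e u) ≈ ∑ p (λ x → 𝟙 (x ℕ.^ suc k′ ≋? u) * χ r x)
  ∑-χ-roots-p∤ r k′ {u} p∤u = *-cancelˡ-≉0 fromℕq≉0 (trans (*-congˡ lhs) (sym rhs))
    where
    k = suc k′
    b = proj₁ (inverse u p∤u)
    ub≋1 = proj₂ (inverse u p∤u)
    G : ℕ → Carrier
    G j = 𝟙 (q ∣? r ℕ.+ k ℕ.* j) * χ j b
    lhs : ∑ q (λ e → 𝟙 (e ℕ.* k Modq.≋? r) * χ e u) ≈ ∑ q G
    lhs = begin
      ∑ q (λ e → 𝟙 (e ℕ.* k Modq.≋? r) * χ e u)      ≈⟨ ∑-cong q (λ e e<q → *-cong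
                                                          (𝟙-cong (e ℕ.* k Modq.≋? r) (q ∣? r ℕ.+ k ℕ.* Modq.neg e) (⇔.sym (Modq.∣+*neg⇔*≋ r k (ℕ.<⇒≤ e<q))))
                                                          (sym (χ-neg {e} {u} {b} e<q ub≋1))) ⟩
      ∑ q (G ∘ Modq.neg)                              ≈⟨ ∑-reindex q Modq.neg Modq.neg (λ _ _ → m%n<n _ q) (λ _ _ → m%n<n _ q)
                                                          (λ _ → Modq.neg-involutive) (λ _ → Modq.neg-involutive) G ⟨
      ∑ q G                                           ∎
    χ-xᵏb : ∀ j x → χ j (x ℕ.^ k ℕ.* b) * χ r x ≈ χ j b * χ (r ℕ.+ k ℕ.* j) x
    χ-xᵏb j x = begin
      χ j (x ℕ.^ k ℕ.* b) * χ r x          ≈⟨ *-congʳ (χ-* j (x ℕ.^ k) b) ⟩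
      χ j (x ℕ.^ k) * χ j b * χ r x        ≈⟨ *-congʳ (*-congʳ (χ-^ j k′ x)) ⟩
      χ (k ℕ.* j) x * χ j b * χ r x        ≈⟨ solve 3 (λ A B C → (A :* B) :* C := B :* (C :* A)) refl (χ (k ℕ.* j) x) (χ j b) (χ r x) ⟩
      χ j b * (χ r x * χ (k ℕ.* j) x)      ≈⟨ *-congˡ (χ-+ r (k ℕ.* j) x) ⟨
      χ j b * χ (r ℕ.+ k ℕ.* j) x          ∎
    rhs : fromℕ R q * ∑ p (λ x → 𝟙 (x ℕ.^ k ≋? u) * χ r x) ≈ fromℕ R q * ∑ q G
    rhs = begin
      fromℕ R q * ∑ p (λ x → 𝟙 (x ℕ.^ k ≋? u) * χ r x)       ≈⟨ ∑-*ˡ p (fromℕ R q) (λ x → 𝟙 (x ℕ.^ k ≋? u) * χ r x) ⟩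
      ∑ p (λ x → fromℕ R q * (𝟙 (x ℕ.^ k ≋? u) * χ r x))     ≈⟨ ∑-cong p (λ x _ → trans (sym (*-assoc (fromℕ R q) (𝟙 (x ℕ.^ k ≋? u)) (χ r x)))
                                                                  (*-congʳ (𝟙≋≈D ub≋1 (x ℕ.^ k)))) ⟩
      ∑ p (λ x → D (x ℕ.^ k ℕ.* b) * χ r x)                   ≈⟨ ∑-cong p (λ x _ → ∑-*ʳ q (χ r x) (λ j → χ j (x ℕ.^ k ℕ.* b))) ⟩
      ∑ p (λ x → ∑ q (λ j → χ j (x ℕ.^ k ℕ.* b) * χ r x))     ≈⟨ ∑-comm p q (λ x j → χ j (x ℕ.^ k ℕ.* b) * χ r x) ⟩
      ∑ q (λ j → ∑ p (λ x → χ j (x ℕ.^ k ℕ.* b) * χ r x))     ≈⟨ ∑-cong q (λ j _ → ∑-cong p (λ x _ → χ-xᵏb j x)) ⟩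
      ∑ q (λ j → ∑ p (λ x → χ j b * χ (r ℕ.+ k ℕ.* j) x))     ≈⟨ ∑-cong q (λ j _ → ∑-*ˡ p (χ j b) (χ (r ℕ.+ k ℕ.* j))) ⟨
      ∑ q (λ j → χ j b * S (r ℕ.+ k ℕ.* j))                   ≈⟨ ∑-cong q (λ j _ → trans (*-congˡ (S≈q𝟙 (r ℕ.+ k ℕ.* j)))
                                                                  (solve 3 (λ A B C → A :* (B :* C) := B :* (C :* A)) refl (χ j b) (fromℕ R q) (𝟙 (q ∣? r ℕ.+ k ℕ.* j)))) ⟩
      ∑ q (λ j → fromℕ R q * G j)                              ≈⟨ ∑-*ˡ q (fromℕ R q) G ⟨
      fromℕ R q * ∑ q G                                        ∎

  ∑-χ-roots-p∣ : ∀ r k′ {u} → p ∣ u →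
    ∑ q (λ e → 𝟙 (e ℕ.* suc k′ Modq.≋? r) * χ e u) ≈ ∑ p (λ x → 𝟙 (x ℕ.^ suc k′ ≋? u) * χ r x)
  ∑-χ-roots-p∣ r k′ {u} p∣u = trans
    (∑-zero q {λ e → 𝟙 (e ℕ.* suc k′ Modq.≋? r) * χ e u} (λ e _ → trans (*-congˡ (χ-p∣ e p∣u)) (zeroʳ _)))
    (sym (∑-zero p {λ x → 𝟙 (x ℕ.^ suc k′ ≋? u) * χ r x} (λ x _ → root-term x (x ℕ.^ suc k′ ≋? u))))
    where
    root-term : ∀ x (d : Dec (x ℕ.^ suc k′ ≋ u)) → 𝟙 d * χ r x ≈ 0#
    root-term x (yes xᵏ≋u) = trans (*-congˡ (χ-p∣ r (p∣^⇒p∣ k′ (∣-resp-≋ (≋-sym xᵏ≋u) p∣u)))) (zeroʳ _)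
    root-term x (no _) = zeroˡ _

  ∑-χ-roots : ∀ r k′ u →
    ∑ q (λ e → 𝟙 (e ℕ.* suc k′ Modq.≋? r) * χ e u) ≈ ∑ p (λ x → 𝟙 (x ℕ.^ suc k′ ≋? u) * χ r x)
  ∑-χ-roots r k′ u = [ ∑-χ-roots-p∣ r k′ , ∑-χ-roots-p∤ r k′ ]′ (toSum (p ∣? u))

  ∑-𝟙≋ : ∀ z (g : ℕ → Carrier) → ∑ p (λ u → 𝟙 (z ≋? u) * g u) ≈ g (z % p)
  ∑-𝟙≋ z g = begin
    ∑ p (λ u → 𝟙 (z ≋? u) * g u)   ≈⟨ ∑-single p (z % p) {λ u → 𝟙 (z ≋? u) * g u} (m%n<n z p) (λ u u<p u≢z% →
                                        trans (*-congʳ (𝟙-no (z ≋? u) (λ z≋u →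
                                          u≢z% (≋⇒≡ u<p (m%n<n z p) (≋-trans (≋-sym z≋u) (≋-sym (%-≋ z)))))))
                                        (zeroˡ _)) ⟩
    𝟙 (z ≋? z % p) * g (z % p)     ≈⟨ *-congʳ (𝟙-yes (z ≋? z % p) (≋-sym (%-≋ z))) ⟩
    1# * g (z % p)                 ≈⟨ *-identityˡ _ ⟩
    g (z % p)                      ∎

  module Quadratic (p-odd : p % 2 ≡ 1) where

    h : ℕ
    h = q / 2

    φ : ℕ → Carrier
    φ = χ h

    h+h≡q : h ℕ.+ h ≡ q
    h+h≡q = ≡.trans (≡.cong (λ z → z ℕ.+ z) h≡p/2) (≡.trans (double (p / 2)) (≡.sym q≡p/2*2))
      where
      q≡p/2*2 : q ≡ p / 2 ℕ.* 2
      q≡p/2*2 = ≡.cong (_∸ 1) (≡.trans (m≡m%n+[m/n]*n p 2) (≡.cong (ℕ._+ p / 2 ℕ.* 2) p-odd))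
      h≡p/2 : h ≡ p / 2
      h≡p/2 = ≡.trans (≡.cong (_/ 2) q≡p/2*2) (m*n/n≡m (p / 2) 2)
      double : ∀ z → z ℕ.+ z ≡ z ℕ.* 2
      double = solve-∀

    0<h : 0 < h
    0<h = ℕ.n≢0⇒n>0 (λ h≡0 → ℕ.<-irrefl (≡.trans (≡.cong (λ z → z ℕ.+ z) (≡.sym h≡0)) h+h≡q) 0<q)

    h<q : h < q
    h<q = ≡.subst (h <_) h+h≡q (ℕ.m<m+n h 0<h)

    φ-inverse : ∀ {a b} → a ℕ.* b ≋ 1 → φ b ≈ φ a
    φ-inverse {a} {b} ab≋1 = begin
      φ b                  ≈⟨ *-identityˡ _ ⟨
      1# * φ b             ≈⟨ *-congʳ (trans (sym (χ-* h a b)) (trans (χ-≋ h ab≋1) (χ-1 h))) ⟨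
      φ a * φ b * φ b      ≈⟨ *-assoc _ _ _ ⟩
      φ a * (φ b * φ b)    ≈⟨ *-congˡ (χ-+ h h b) ⟨
      φ a * χ (h ℕ.+ h) b  ≈⟨ *-congˡ (χ-q∣ (≡.subst (q ∣_) (≡.sym h+h≡q) ∣-refl) (inverse-p∤ {a} ab≋1)) ⟩
      φ a * 1#             ≈⟨ *-identityʳ _ ⟩
      φ a                  ∎

    S-double-<h : ∀ i → 0 < i → i < h → S (i ℕ.+ i) ≈ 0#
    S-double-<h i 0<i i<h =
      S-<q (i ℕ.+ i) (ℕ.<-≤-trans 0<i (ℕ.m≤m+n i i)) (≡.subst (i ℕ.+ i <_) h+h≡q (ℕ.+-mono-< i<h i<h))

    ∑-sqrt-p∤ : ∀ {a} → ¬ p ∣ a → ∑ p (λ y → 𝟙 (y ℕ.* y ≋? a)) ≈ 1# + φ a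
    ∑-sqrt-p∤ {a} p∤a = *-cancelˡ-≉0 fromℕq≉0 (begin
      fromℕ R q * ∑ p (λ y → 𝟙 (y ℕ.* y ≋? a))          ≈⟨ ∑-*ˡ p (fromℕ R q) (λ y → 𝟙 (y ℕ.* y ≋? a)) ⟩
      ∑ p (λ y → fromℕ R q * 𝟙 (y ℕ.* y ≋? a))          ≈⟨ ∑-cong p (λ y _ → 𝟙≋≈D ab≋1 (y ℕ.* y)) ⟩
      ∑ p (λ y → D (y ℕ.* y ℕ.* b))                      ≈⟨ ∑-comm p q (λ y j → χ j (y ℕ.* y ℕ.* b)) ⟩
      ∑ q (λ j → ∑ p (λ y → χ j (y ℕ.* y ℕ.* b)))        ≈⟨ ∑-cong q (λ j _ → ∑-cong p (λ y _ → χ-y²b j y)) ⟩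
      ∑ q (λ j → ∑ p (λ y → χ j b * χ (j ℕ.+ j) y))      ≈⟨ ∑-cong q (λ j _ → ∑-*ˡ p (χ j b) (χ (j ℕ.+ j))) ⟨
      ∑ q F                                              ≡⟨ ≡.cong (λ n → ∑ n F) h+h≡q ⟨
      ∑ (h ℕ.+ h) F                                      ≈⟨ ∑-split h h F ⟩
      ∑ h F + ∑ h (λ i → F (h ℕ.+ i))                    ≈⟨ +-cong ∑F≈q ∑F[h+]≈φb*q ⟩
      fromℕ R q * 1# + fromℕ R q * φ b                   ≈⟨ distribˡ _ _ _ ⟨
      fromℕ R q * (1# + φ b)                             ≈⟨ *-congˡ (+-congˡ (φ-inverse ab≋1)) ⟩
      fromℕ R q * (1# + φ a)                             ∎)
      where
      b = proj₁ (inverse a p∤a)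
      ab≋1 = proj₂ (inverse a p∤a)
      F : ℕ → Carrier
      F j = χ j b * S (j ℕ.+ j)
      χ-y²b : ∀ j y → χ j (y ℕ.* y ℕ.* b) ≈ χ j b * χ (j ℕ.+ j) y
      χ-y²b j y = begin
        χ j (y ℕ.* y ℕ.* b)        ≈⟨ χ-* j (y ℕ.* y) b ⟩
        χ j (y ℕ.* y) * χ j b      ≈⟨ *-comm _ _ ⟩
        χ j b * χ j (y ℕ.* y)      ≈⟨ *-congˡ (χ-* j y y) ⟩
        χ j b * (χ j y * χ j y)    ≈⟨ *-congˡ (χ-+ j j y) ⟨
        χ j b * χ (j ℕ.+ j) y      ∎
      ∑F≈q : ∑ h F ≈ fromℕ R q * 1#
      ∑F≈q = begin
        ∑ h F               ≈⟨ ∑-single h 0 {F} 0<h (λ j j<h j≢0 →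
                                 trans (*-congˡ (S-double-<h j (ℕ.n≢0⇒n>0 j≢0) j<h)) (zeroʳ _)) ⟩
        χ 0 b * S 0         ≈⟨ *-cong (χ₀ (inverse-p∤ {a} ab≋1)) S-0 ⟩
        1# * fromℕ R q      ≈⟨ *-comm _ _ ⟩
        fromℕ R q * 1#      ∎
      ∑F[h+]≈φb*q : ∑ h (λ i → F (h ℕ.+ i)) ≈ fromℕ R q * φ b
      ∑F[h+]≈φb*q = begin
        ∑ h (λ i → F (h ℕ.+ i))   ≈⟨ ∑-single h 0 {λ i → F (h ℕ.+ i)} 0<h (λ i i<h i≢0 →
                                       trans (*-congˡ (S-h+i i (ℕ.n≢0⇒n>0 i≢0) i<h)) (zeroʳ _)) ⟩
        F (h ℕ.+ 0)               ≡⟨ ≡.cong F (ℕ.+-identityʳ h) ⟩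
        φ b * S (h ℕ.+ h)         ≈⟨ *-congˡ (trans (reflexive (≡.cong S h+h≡q)) (trans (S-+q 0) S-0)) ⟩
        φ b * fromℕ R q           ≈⟨ *-comm _ _ ⟩
        fromℕ R q * φ b           ∎
        where
        S-h+i : ∀ i → 0 < i → i < h → S ((h ℕ.+ i) ℕ.+ (h ℕ.+ i)) ≈ 0#
        S-h+i i 0<i i<h = begin
          S ((h ℕ.+ i) ℕ.+ (h ℕ.+ i))   ≡⟨ ≡.cong S (rearrange h i) ⟩
          S ((i ℕ.+ i) ℕ.+ (h ℕ.+ h))   ≡⟨ ≡.cong (λ m → S ((i ℕ.+ i) ℕ.+ m)) h+h≡q ⟩
          S ((i ℕ.+ i) ℕ.+ q)           ≈⟨ S-+q (i ℕ.+ i) ⟩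
          S (i ℕ.+ i)                   ≈⟨ S-double-<h i 0<i i<h ⟩
          0#                            ∎
          where
          rearrange : ∀ h i → (h ℕ.+ i) ℕ.+ (h ℕ.+ i) ≡ (i ℕ.+ i) ℕ.+ (h ℕ.+ h)
          rearrange = solve-∀

    ∑-sqrt-p∣ : ∀ {a} → p ∣ a → ∑ p (λ y → 𝟙 (y ℕ.* y ≋? a)) ≈ 1# + φ a
    ∑-sqrt-p∣ {a} p∣a = begin
      ∑ p (λ y → 𝟙 (y ℕ.* y ≋? a))   ≈⟨ ∑-single p 0 {λ y → 𝟙 (y ℕ.* y ≋? a)} (ℕ.>-nonZero⁻¹ p) (λ y y<p y≢0 →
                                          𝟙-no (y ℕ.* y ≋? a) (λ y²≋a → p∤-* (<p⇒p∤ y<p y≢0) (<p⇒p∤ y<p y≢0)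
                                                                            (∣-resp-≋ (≋-sym y²≋a) p∣a))) ⟩
      𝟙 (0 ≋? a)                     ≈⟨ 𝟙-yes (0 ≋? a) (≋-sym (∣⇒≋0 p∣a)) ⟩
      1#                             ≈⟨ +-identityʳ 1# ⟨
      1# + 0#                        ≈⟨ +-congˡ (χ-p∣ h p∣a) ⟨
      1# + φ a                       ∎

    ∑-sqrt : ∀ a → ∑ p (λ y → 𝟙 (y ℕ.* y ≋? a)) ≈ 1# + φ a
    ∑-sqrt a = [ ∑-sqrt-p∣ , ∑-sqrt-p∤ ]′ (toSum (p ∣? a))

    module Curve (k′ c : ℕ) (p∤c : ¬ p ∣ c) where

      k d : ℕ
      k = suc k′
      d = suc k

      A : ℕ → Carrier
      A e = χ e (p ℕ.* c ∸ c) * φ c * jacobi R p (χ e) φ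

      -- Defs introduces the summands of term and curveCount in where clauses; these name them.
      term-summand : ∀ m → ∃[ g ] term R p d c T m ≡ sumR R q g
      term-summand m = _ , ≡.refl

      term-summand≈ : ∀ m e → proj₁ (term-summand m) e ≈ 𝟙 (e ℕ.* (2 ℕ.* k) ℕ.≟ (1 ℕ.+ 2 ℕ.* m) ℕ.* q) * A e
      term-summand≈ m e with e ℕ.* (2 ℕ.* k) ℕ.≟ (1 ℕ.+ 2 ℕ.* m) ℕ.* q
      ... | yes _ = sym (*-identityˡ _)
      ... | no _ = sym (zeroˡ _)

      term≈ : ∀ m → term R p d c T m ≈ ∑ q (λ e → 𝟙 (e ℕ.* (2 ℕ.* k) ℕ.≟ (1 ℕ.+ 2 ℕ.* m) ℕ.* q) * A e)
      term≈ m = begin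
        term R p d c T m                ≡⟨ proj₂ (term-summand m) ⟩
        sumR R q (proj₁ (term-summand m)) ≈⟨ sumR≈∑ q (proj₁ (term-summand m)) ⟩
        ∑ q (proj₁ (term-summand m))    ≈⟨ ∑-cong q (λ e _ → term-summand≈ m e) ⟩
        ∑ q (λ e → 𝟙 (e ℕ.* (2 ℕ.* k) ℕ.≟ (1 ℕ.+ 2 ℕ.* m) ℕ.* q) * A e) ∎

      2ek≡[1+2m]q⇔ek≡h+mq : ∀ e m → e ℕ.* (2 ℕ.* k) ≡ (1 ℕ.+ 2 ℕ.* m) ℕ.* q ⇔ e ℕ.* k ≡ h ℕ.+ m ℕ.* q
      2ek≡[1+2m]q⇔ek≡h+mq e m = mk⇔
        (λ eq → double-injective (≡.trans (≡.sym (double-e e k)) (≡.trans eq [1+2m]q≡2[h+mq])))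
        (λ eq → ≡.trans (double-e e k) (≡.trans (≡.cong (λ z → z ℕ.+ z) eq) (≡.sym [1+2m]q≡2[h+mq])))
        where
        double-e : ∀ e k → e ℕ.* (2 ℕ.* k) ≡ e ℕ.* k ℕ.+ e ℕ.* k
        double-e = solve-∀
        double-injective : ∀ {x y} → x ℕ.+ x ≡ y ℕ.+ y → x ≡ y
        double-injective {x} {y} eq = ℕ.*-cancelˡ-≡ x y 2 (≡.trans (twice x) (≡.trans eq (≡.sym (twice y))))
          where
          twice : ∀ z → 2 ℕ.* z ≡ z ℕ.+ z
          twice = solve-∀
        [1+2m]q≡2[h+mq] : (1 ℕ.+ 2 ℕ.* m) ℕ.* q ≡ (h ℕ.+ m ℕ.* q) ℕ.+ (h ℕ.+ m ℕ.* q)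
        [1+2m]q≡2[h+mq] = ≡.trans (expand m q) (≡.trans (≡.cong (λ z → z ℕ.+ (m ℕ.* q ℕ.+ m ℕ.* q)) (≡.sym h+h≡q))
                            (regroup h (m ℕ.* q)))
          where
          expand : ∀ m q → (1 ℕ.+ 2 ℕ.* m) ℕ.* q ≡ q ℕ.+ (m ℕ.* q ℕ.+ m ℕ.* q)
          expand = solve-∀
          regroup : ∀ h y → (h ℕ.+ h) ℕ.+ (y ℕ.+ y) ≡ (h ℕ.+ y) ℕ.+ (h ℕ.+ y)
          regroup = solve-∀

      ∑-𝟙-odd-multiple : ∀ e → e < q →
        ∑ (d ℕ.* p) (λ m → 𝟙 (e ℕ.* (2 ℕ.* k) ℕ.≟ (1 ℕ.+ 2 ℕ.* m) ℕ.* q)) ≈ 𝟙 (e ℕ.* k Modq.≋? h)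
      ∑-𝟙-odd-multiple e e<q = count (e ℕ.* k Modq.≋? h)
        where
        f : ℕ → Carrier
        f m = 𝟙 (e ℕ.* (2 ℕ.* k) ℕ.≟ (1 ℕ.+ 2 ℕ.* m) ℕ.* q)
        count : (dec : Dec (e ℕ.* k Modq.≋ h)) → ∑ (d ℕ.* p) f ≈ 𝟙 dec
        count (no ek≉h) = ∑-zero (d ℕ.* p) {f} (λ m _ → 𝟙-no (e ℕ.* (2 ℕ.* k) ℕ.≟ (1 ℕ.+ 2 ℕ.* m) ℕ.* q)
          (λ eq → ek≉h (Modq.≋-trans (Modq.≡⇒≋ (Equivalence.to (2ek≡[1+2m]q⇔ek≡h+mq e m) eq)) (Modq.+*-≋ h m))))
        count (yes ek≋h) = trans (∑-single (d ℕ.* p) m₀ {f} m₀<dp others)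
                                 (𝟙-yes (e ℕ.* (2 ℕ.* k) ℕ.≟ (1 ℕ.+ 2 ℕ.* m₀) ℕ.* q)
                                        (Equivalence.from (2ek≡[1+2m]q⇔ek≡h+mq e m₀) ek≡h+m₀q))
          where
          m₀ = e ℕ.* k / q
          ek≡h+m₀q : e ℕ.* k ≡ h ℕ.+ m₀ ℕ.* q
          ek≡h+m₀q = ≡.trans (m≡m%n+[m/n]*n (e ℕ.* k) q) (≡.cong (ℕ._+ m₀ ℕ.* q) (≡.trans ek≋h (m<n⇒m%n≡m h<q)))
          m₀<dp : m₀ < d ℕ.* p
          m₀<dp = ℕ.≤-<-trans m₀≤ek (ℕ.≤-<-trans (ℕ.*-monoʳ-≤ e (ℕ.n≤1+n k)) ed<dp)
            where
            m₀≤ek : m₀ ≤ e ℕ.* k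
            m₀≤ek = ℕ.≤-trans (ℕ.m≤m*n m₀ q) (ℕ.≤-trans (ℕ.m≤n+m _ h) (ℕ.≤-reflexive (≡.sym ek≡h+m₀q)))
            ed<dp : e ℕ.* d < d ℕ.* p
            ed<dp = ≡.subst (e ℕ.* d <_) (ℕ.*-comm p d)
                      (ℕ.*-monoˡ-< d (ℕ.<-trans e<q (≡.subst (q <_) (≡.sym p≡1+q) (ℕ.n<1+n q))))
          others : ∀ m → m < d ℕ.* p → m ≢ m₀ → f m ≈ 0#
          others m _ m≢m₀ = 𝟙-no (e ℕ.* (2 ℕ.* k) ℕ.≟ (1 ℕ.+ 2 ℕ.* m) ℕ.* q) (λ eq → m≢m₀ (ℕ.*-cancelʳ-≡ m m₀ q
            (ℕ.+-cancelˡ-≡ h _ _ (≡.trans (≡.sym (Equivalence.to (2ek≡[1+2m]q⇔ek≡h+mq e m) eq)) ek≡h+m₀q))))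

      mainSum≈ : mainSum R p d c T ≈ ∑ q (λ e → 𝟙 (e ℕ.* k Modq.≋? h) * A e)
      mainSum≈ = begin
        mainSum R p d c T                                           ≈⟨ sumR≈∑ (d ℕ.* p) (term R p d c T) ⟩
        ∑ (d ℕ.* p) (term R p d c T)                                ≈⟨ ∑-cong (d ℕ.* p) (λ m _ → term≈ m) ⟩
        ∑ (d ℕ.* p) (λ m → ∑ q (λ e → f m e * A e))                 ≈⟨ ∑-comm (d ℕ.* p) q (λ m e → f m e * A e) ⟩
        ∑ q (λ e → ∑ (d ℕ.* p) (λ m → f m e * A e))                 ≈⟨ ∑-cong q (λ e _ → ∑-*ʳ (d ℕ.* p) (A e) (λ m → f m e)) ⟨
        ∑ q (λ e → ∑ (d ℕ.* p) (λ m → f m e) * A e)                 ≈⟨ ∑-cong q (λ e e<q → *-congʳ {A e} (∑-𝟙-odd-multiple e e<q)) ⟩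
        ∑ q (λ e → 𝟙 (e ℕ.* k Modq.≋? h) * A e)                      ∎
        where
        f : ℕ → ℕ → Carrier
        f m e = 𝟙 (e ℕ.* (2 ℕ.* k) ℕ.≟ (1 ℕ.+ 2 ℕ.* m) ℕ.* q)

      w : ℕ
      w = p ℕ.* c ∸ c

      w+c≡pc : w ℕ.+ c ≡ p ℕ.* c
      w+c≡pc = ℕ.m∸n+n≡m (ℕ.m≤n*m c p)

      p∤w : ¬ p ∣ w
      p∤w p∣w = p∤c (∣m+n∣m⇒∣n (≡.subst (p ∣_) (≡.sym w+c≡pc) (∣m⇒∣m*n c ∣-refl)) p∣w)

      A≈ : ∀ e → A e ≈ ∑ p (λ u → χ e u * φ (c ℕ.+ u))
      A≈ e = begin
        χ e w * φ c * jacobi R p (χ e) φ                        ≈⟨ *-congˡ (sumR≈∑ p (λ t → χ e t * φ ((1 ℕ.+ p) ∸ t))) ⟩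
        χ e w * φ c * ∑ p (λ t → χ e t * φ ((1 ℕ.+ p) ∸ t))     ≈⟨ ∑-*ˡ p (χ e w * φ c) (λ t → χ e t * φ ((1 ℕ.+ p) ∸ t)) ⟩
        ∑ p (λ t → χ e w * φ c * (χ e t * φ ((1 ℕ.+ p) ∸ t)))   ≈⟨ ∑-cong p substitute ⟩
        ∑ p (λ t → F ((w ℕ.* t) % p))                           ≈⟨ ∑-reindex-* +-commutativeMonoid {w} {w⁻¹} ww⁻¹≋1 F ⟨
        ∑ p F                                                   ∎
        where
        w⁻¹ = proj₁ (inverse w p∤w)
        ww⁻¹≋1 = proj₂ (inverse w p∤w)
        F : ℕ → Carrier
        F u = χ e u * φ (c ℕ.+ u)
        substitute : ∀ t → t < p → χ e w * φ c * (χ e t * φ ((1 ℕ.+ p) ∸ t)) ≈ F ((w ℕ.* t) % p)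
        substitute t t<p = begin
          χ e w * φ c * (χ e t * φ ((1 ℕ.+ p) ∸ t))     ≈⟨ solve 4 (λ A B C D → (A :* B) :* (C :* D) := (A :* C) :* (B :* D)) refl
                                                             (χ e w) (φ c) (χ e t) (φ ((1 ℕ.+ p) ∸ t)) ⟩
          χ e w * χ e t * (φ c * φ ((1 ℕ.+ p) ∸ t))     ≈⟨ *-cong (χ-* e w t) (χ-* h c ((1 ℕ.+ p) ∸ t)) ⟨
          χ e (w ℕ.* t) * φ (c ℕ.* ((1 ℕ.+ p) ∸ t))     ≈⟨ *-cong (χ-≋ e (≋-sym (%-≋ (w ℕ.* t)))) (χ-≋ h (c*[1+n∸t]≋c+w*t t (ℕ.<⇒≤ (ℕ.m<n⇒m<1+n t<p)) w+c≡pc)) ⟩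
          F ((w ℕ.* t) % p)                             ∎

      ∑-𝟙A≈∑φ : ∑ q (λ e → 𝟙 (e ℕ.* k Modq.≋? h) * A e) ≈ ∑ p (λ x → φ (x ℕ.^ d ℕ.+ c ℕ.* x))
      ∑-𝟙A≈∑φ = begin
        ∑ q (λ e → 𝟙ₕ e * A e)                                     ≈⟨ ∑-cong q (λ e _ → *-congˡ {𝟙ₕ e} (A≈ e)) ⟩
        ∑ q (λ e → 𝟙ₕ e * ∑ p (λ u → χ e u * φ (c ℕ.+ u)))         ≈⟨ ∑-cong q (λ e _ → ∑-*ˡ p (𝟙ₕ e) (λ u → χ e u * φ (c ℕ.+ u))) ⟩
        ∑ q (λ e → ∑ p (λ u → 𝟙ₕ e * (χ e u * φ (c ℕ.+ u))))       ≈⟨ ∑-comm q p (λ e u → 𝟙ₕ e * (χ e u * φ (c ℕ.+ u))) ⟩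
        ∑ p (λ u → ∑ q (λ e → 𝟙ₕ e * (χ e u * φ (c ℕ.+ u))))       ≈⟨ ∑-cong p (λ u _ → trans
                                                                        (∑-cong q (λ e _ → sym (*-assoc (𝟙ₕ e) (χ e u) (φ (c ℕ.+ u)))))
                                                                        (sym (∑-*ʳ q (φ (c ℕ.+ u)) (λ e → 𝟙ₕ e * χ e u)))) ⟩
        ∑ p (λ u → ∑ q (λ e → 𝟙ₕ e * χ e u) * φ (c ℕ.+ u))         ≈⟨ ∑-cong p (λ u _ → *-congʳ {φ (c ℕ.+ u)} (∑-χ-roots h k′ u)) ⟩
        ∑ p (λ u → ∑ p (λ x → root x u * φ x) * φ (c ℕ.+ u))       ≈⟨ ∑-cong p (λ u _ → ∑-*ʳ p (φ (c ℕ.+ u)) (λ x → root x u * φ x)) ⟩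
        ∑ p (λ u → ∑ p (λ x → root x u * φ x * φ (c ℕ.+ u)))       ≈⟨ ∑-comm p p (λ u x → root x u * φ x * φ (c ℕ.+ u)) ⟩
        ∑ p (λ x → ∑ p (λ u → root x u * φ x * φ (c ℕ.+ u)))       ≈⟨ ∑-cong p (λ x _ → trans
                                                                        (∑-cong p (λ u _ → solve 3 (λ A B C → (A :* B) :* C := B :* (A :* C)) refl
                                                                                               (root x u) (φ x) (φ (c ℕ.+ u))))
                                                                        (sym (∑-*ˡ p (φ x) (λ u → root x u * φ (c ℕ.+ u))))) ⟩
        ∑ p (λ x → φ x * ∑ p (λ u → root x u * φ (c ℕ.+ u)))       ≈⟨ ∑-cong p (λ x _ → *-congˡ {φ x} (∑-𝟙≋ (x ℕ.^ k) (λ u → φ (c ℕ.+ u)))) ⟩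
        ∑ p (λ x → φ x * φ (c ℕ.+ (x ℕ.^ k) % p))                  ≈⟨ ∑-cong p (λ x _ → trans (sym (χ-* h x _)) (χ-≋ h (x[c+xᵏ]≋xᵈ+cx x))) ⟩
        ∑ p (λ x → φ (x ℕ.^ d ℕ.+ c ℕ.* x))                        ∎
        where
        𝟙ₕ : ℕ → Carrier
        𝟙ₕ e = 𝟙 (e ℕ.* k Modq.≋? h)
        root : ℕ → ℕ → Carrier
        root x u = 𝟙 (x ℕ.^ k ≋? u)
        x[c+xᵏ]≋xᵈ+cx : ∀ x → x ℕ.* (c ℕ.+ (x ℕ.^ k) % p) ≋ x ℕ.^ d ℕ.+ c ℕ.* x
        x[c+xᵏ]≋xᵈ+cx x = ≋-trans (≋-* (≋-refl {x}) (≋-+ (≋-refl {c}) (%-≋ (x ℕ.^ k)))) (≡⇒≋ (expand x c (x ℕ.^ k)))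
          where
          expand : ∀ x c y → x ℕ.* (c ℕ.+ y) ≡ x ℕ.* y ℕ.+ c ℕ.* x
          expand = solve-∀

      curve-summand : ∃[ f ] curveCount p d c ≡ ℕSum.sumList (cartesianProduct (upTo p) (upTo p)) f
      curve-summand = _ , ≡.refl

      curve-summand≈ : ∀ x y → fromℕ R (proj₁ curve-summand (x , y)) ≈ 𝟙 (y ℕ.* y ≋? x ℕ.^ d ℕ.+ c ℕ.* x)
      curve-summand≈ x y = trans (summand≈𝟙 x y) (𝟙-cong (p ∣? ∣ y ℕ.^ 2 - (x ℕ.^ d ℕ.+ c ℕ.* x) ∣) (y ℕ.* y ≋? x ℕ.^ d ℕ.+ c ℕ.* x)
        (≡.subst (λ z → p ∣ ∣ y ℕ.^ 2 - (x ℕ.^ d ℕ.+ c ℕ.* x) ∣ ⇔ (z ≋ x ℕ.^ d ℕ.+ c ℕ.* x)) (≡.cong (y ℕ.*_) (ℕ.*-identityʳ y))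
           (⇔.sym (≋⇔∣∣-∣ (y ℕ.^ 2) (x ℕ.^ d ℕ.+ c ℕ.* x)))))
        where
        summand≈𝟙 : ∀ x y → fromℕ R (proj₁ curve-summand (x , y)) ≈ 𝟙 (p ∣? ∣ y ℕ.^ 2 - (x ℕ.^ d ℕ.+ c ℕ.* x) ∣)
        summand≈𝟙 x y with p ∣? ∣ y ℕ.^ 2 - (x ℕ.^ d ℕ.+ c ℕ.* x) ∣
        ... | yes _ = +-identityʳ 1#
        ... | no _ = refl

      point-count : fromℕ R (curveCount p d c) ≈ fromℕ R p + ∑ p (λ x → φ (x ℕ.^ d ℕ.+ c ℕ.* x))
      point-count = begin
        fromℕ R (curveCount p d c)                                            ≡⟨ ≡.cong (fromℕ R) (proj₂ curve-summand) ⟩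
        fromℕ R (ℕSum.sumList (cartesianProduct (upTo p) (upTo p)) f)         ≈⟨ fromℕ-sumList (cartesianProduct (upTo p) (upTo p)) f ⟩
        sumList (cartesianProduct (upTo p) (upTo p)) (fromℕ R ∘ f)            ≈⟨ sumList-cartesianProduct (upTo p) (upTo p) (fromℕ R ∘ f) ⟩
        sumR R p (λ x → sumR R p (λ y → fromℕ R (f (x , y))))                 ≈⟨ sumR≈∑ p (λ x → sumR R p (λ y → fromℕ R (f (x , y)))) ⟩
        ∑ p (λ x → sumR R p (λ y → fromℕ R (f (x , y))))                      ≈⟨ ∑-cong p (λ x _ → trans (sumR≈∑ p (λ y → fromℕ R (f (x , y))))
                                                                                   (∑-cong p (λ y _ → curve-summand≈ x y))) ⟩
        ∑ p (λ x → ∑ p (λ y → 𝟙 (y ℕ.* y ≋? x ℕ.^ d ℕ.+ c ℕ.* x)))            ≈⟨ ∑-cong p (λ x _ → ∑-sqrt (x ℕ.^ d ℕ.+ c ℕ.* x)) ⟩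
        ∑ p (λ x → 1# + φ (x ℕ.^ d ℕ.+ c ℕ.* x))                              ≈⟨ ∑-distrib p (λ _ → 1#) (λ x → φ (x ℕ.^ d ℕ.+ c ℕ.* x)) ⟩
        ∑ p (λ _ → 1#) + ∑ p (λ x → φ (x ℕ.^ d ℕ.+ c ℕ.* x))                  ≈⟨ +-congʳ (∑-1# p) ⟩
        fromℕ R p + ∑ p (λ x → φ (x ℕ.^ d ℕ.+ c ℕ.* x))                       ∎
        where
        f = proj₁ curve-summand

      Nd≈ : fromℕ R (Nd p d c) ≈ fromℕ R (p ℕ.+ 1) + mainSum R p d c T
      Nd≈ = begin
        fromℕ R (Nd p d c)                   ≡⟨⟩
        1# + fromℕ R (curveCount p d c)      ≈⟨ +-congˡ point-count ⟩
        1# + (fromℕ R p + ∑φ)                ≈⟨ +-assoc 1# (fromℕ R p) ∑φ ⟨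
        1# + fromℕ R p + ∑φ                  ≈⟨ +-cong (trans (+-comm 1# (fromℕ R p)) (sym p+1≈)) (sym (trans mainSum≈ ∑-𝟙A≈∑φ)) ⟩
        fromℕ R (p ℕ.+ 1) + mainSum R p d c T ∎
        where
        ∑φ = ∑ p (λ x → φ (x ℕ.^ d ℕ.+ c ℕ.* x))
        p+1≈ : fromℕ R (p ℕ.+ 1) ≈ fromℕ R p + 1#
        p+1≈ = trans (fromℕ-+ p 1) (+-congˡ (+-identityʳ 1#))

open import Data.Nat using (_+_)

theoremB1 : ∀ {a ℓ : Level} (R : CommutativeRing a ℓ) →
    IsIntegralDomain R → CharZero R →
    (p d c : ℕ) → Prime p → p % 2 ≡ 1 → 2 ≤ d → ¬ (p ∣ c) →
    (T : ℕ → CommutativeRing.Carrier R) →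
    IsCharacter R p T → IsGenerator R p T →
    CommutativeRing._≈_ R (fromℕ R (Nd p d c))
      (CommutativeRing._+_ R (fromℕ R (p + 1)) (mainSum R p d c T))
theoremB1 R dom ch0 p (suc (suc k′)) c pr p-odd (s≤s (s≤s z≤n)) p∤c T isC gen =
  Characters.Quadratic.Curve.Nd≈ R dom ch0 p pr T isC gen p-odd k′ c p∤c
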